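{- Let $G$ be a tree and let $p$ be the maximum length (number of edges) of a path in $G$. Then $\operatorname{diam}(\mathrm{CIM}_G)\geq \left\lfloor \frac{p}{2}\right\rfloor$.
   Context: For a directed acyclic graph (DAG) $\mathcal{G}$ on vertex set $[n]$, let $\mathrm{pa}_{\mathcal{G}}(i)$ denote the set of parents of $i$. The characteristic imset of $\mathcal{G}$ is the 0/1-vector $c_{\mathcal{G}}$ indexed by subsets $S\subseteq[n]$ with $|S|\geq 2$, with $c_{\mathcal{G}}(S)=1$ iff there exists $i\in S$ with $S\subseteq \mathrm{pa}_{\mathcal{G}}(i)\cup\{i\}$. The skeleton of a DAG is its underlying undirected graph. For an undirected graph $G$ on $[n]$, $\mathrm{CIM}_G$ is the convex hull of all $c_{\mathcal{G}}$ with $\mathcal{G}$ a DAG with skeleton $G$. The diameter $\operatorname{diam}(P)$ of a polytope $P$ is the maximum, over pairs of vertices of $P$, of the length of a shortest path between them in the vertex-edge graph of $P$ (nodes are vertices of $P$, two adjacent iff their convex hull is an edge of $P$). -}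

module Defs where

open import Data.Nat using (ℕ; zero; suc; _≤_; _≤?_)
open import Data.Bool using (Bool; true; false; T; _∧_; _∨_; not; if_then_else_)
open import Data.Fin using (Fin; _≟_)
open import Data.Fin.Subset using (Subset; ∣_∣)
open import Data.Vec using (Vec; []; _∷_; lookup)
open import Data.List using (List; []; _∷_; length; map; foldr; last)
open import Data.Bool.ListAction using (any; all)
open import Data.List.Relation.Unary.Linked using (Linked)
open import Data.List.Relation.Unary.Unique.Propositional using (Unique)
open import Data.Maybe using (just)
open import Data.Product using (Σ; _×_; ∃; ∃-syntax)
open import Data.Sum using (_⊎_)
open import Data.Empty using (⊥)
open import Data.List.Base using (allFin)
open import Relation.Nullary using (¬_)
open import Relation.Nullary.Decidable using (⌊_⌋)
open import Relation.Binary.PropositionalEquality using (_≡_)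
open import Function.Bundles using (_⇔_)
open import Data.Rational using (ℚ; 0ℚ; 1ℚ; _+_; _*_; _<_)

record Graph (n : ℕ) : Set where
  field
    adj   : Fin n → Fin n → Bool
    sym   : ∀ i j → adj i j ≡ adj j i
    irrefl : ∀ i → adj i i ≡ false
open Graph public

Adj : ∀ {n} → Graph n → Fin n → Fin n → Set
Adj G i j = T (adj G i j)

data GWalk {n : ℕ} (G : Graph n) : Fin n → Fin n → Set where
  here : ∀ i → GWalk G i i
  step : ∀ {i j k} → Adj G i j → GWalk G j k → GWalk G i k

Connected : ∀ {n} → Graph n → Set
Connected {n} G = ∀ (i j : Fin n) → GWalk G i j

IsPath : ∀ {n} → Graph n → List (Fin n) → Set
IsPath G xs = Unique xs × Linked (Adj G) xs

IsCycle : ∀ {n} → Graph n → List (Fin n) → Set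
IsCycle G [] = ⊥
IsCycle G (x ∷ xs) =
  (3 ≤ length (x ∷ xs)) × IsPath G (x ∷ xs) ×
  Σ (Fin _) (λ y → (last (x ∷ xs) ≡ just y) × Adj G y x)

Acyclic : ∀ {n} → Graph n → Set
Acyclic G = ∀ xs → ¬ IsCycle G xs

IsTree : ∀ {n} → Graph n → Set
IsTree G = Connected G × Acyclic G

PathOfLength : ∀ {n} → Graph n → List (Fin n) → ℕ → Set
PathOfLength G xs p = IsPath G xs × length xs ≡ suc p

IsMaxPathLength : ∀ {n} → Graph n → ℕ → Set
IsMaxPathLength G p =
  (∃[ xs ] PathOfLength G xs p) ×
  (∀ xs q → PathOfLength G xs q → q ≤ p)

-- DAGs on [n]; arrow i j = true means i → j

record Digraph (n : ℕ) : Set where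
  field
    arrow : Fin n → Fin n → Bool
open Digraph public

Arr : ∀ {n} → Digraph n → Fin n → Fin n → Set
Arr D i j = T (arrow D i j)

IsDirCycle : ∀ {n} → Digraph n → List (Fin n) → Set
IsDirCycle D [] = ⊥
IsDirCycle D (x ∷ xs) =
  Linked (Arr D) (x ∷ xs) × Σ (Fin _) (λ y → (last (x ∷ xs) ≡ just y) × Arr D y x)

IsDAG : ∀ {n} → Digraph n → Set
IsDAG D = ∀ xs → ¬ IsDirCycle D xs

HasSkeleton : ∀ {n} → Digraph n → Graph n → Set
HasSkeleton {n} D G = ∀ (i j : Fin n) → Adj G i j ⇔ (Arr D i j ⊎ Arr D j i)

-- Characteristic imsets, as points of ℚ^{subsets of [n]}
-- (only coordinates S with |S| ≥ 2 are relevant)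

Point : ℕ → Set
Point n = Subset n → ℚ

-- c_D(S) = 1 iff ∃ i ∈ S with S ⊆ pa(i) ∪ {i}
imsetBool : ∀ {n} → Digraph n → Subset n → Bool
imsetBool {n} D S =
  any (λ i → lookup S i ∧
             all (λ j → not (lookup S j) ∨ ⌊ j ≟ i ⌋ ∨ arrow D j i) (allFin n))
      (allFin n)

charImset : ∀ {n} → Digraph n → Point n
charImset D S = if imsetBool D S then 1ℚ else 0ℚ

allSubsets : ∀ n → List (Subset n)
allSubsets zero = [] ∷ []
allSubsets (suc n) =
  foldr (λ S acc → (true ∷ S) ∷ (false ∷ S) ∷ acc) [] (allSubsets n)

_≈P_ : ∀ {n} → Point n → Point n → Set
_≈P_ {n} x y = ∀ (S : Subset n) → 2 ≤ ∣ S ∣ → x S ≡ y S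

dot : ∀ {n} → Point n → Point n → ℚ
dot {n} w x =
  foldr _+_ 0ℚ
    (map (λ S → if ⌊ 2 ≤? ∣ S ∣ ⌋ then w S * x S else 0ℚ) (allSubsets n))

-- The polytope CIM_G = conv { c_D : D a DAG with skeleton G }

IsGenerator : ∀ {n} → Graph n → Point n → Set
IsGenerator G x = ∃[ D ] IsDAG D × HasSkeleton D G × (x ≈P charImset D)

IsVertex : ∀ {n} → Graph n → Point n → Set
IsVertex G u =
  IsGenerator G u ×
  ∃[ w ] (∀ x → IsGenerator G x → ¬ (x ≈P u) → dot w x < dot w u)

IsEdge : ∀ {n} → Graph n → Point n → Point n → Set
IsEdge G u v =
  IsVertex G u × IsVertex G v × ¬ (u ≈P v) ×
  ∃[ w ] ((dot w u ≡ dot w v) ×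
          (∀ x → IsGenerator G x → ¬ (x ≈P u) → ¬ (x ≈P v) → dot w x < dot w u))

data EdgeWalk {n : ℕ} (G : Graph n) : Point n → Point n → ℕ → Set where
  stay : ∀ {u v} → u ≈P v → EdgeWalk G u v zero
  move : ∀ {u v z m} → IsEdge G u v → EdgeWalk G v z m → EdgeWalk G u z (suc m)

DiamAtLeast : ∀ {n} → Graph n → ℕ → Set
DiamAtLeast G k =
  ∃[ u ] ∃[ v ] IsVertex G u × IsVertex G v ×
    (∀ m → EdgeWalk G u v m → k ≤ m)

-- Fix a longest path w₀ … w_p of the tree and let Φ(D) be the number of colliders w_{i-1} → w_i ← w_{i+1}
-- of a DAG D along it. Since the ends of such a triple are not adjacent, Φ(D) is read off c_D at the
-- coordinates {w_{i-1}, w_i, w_{i+1}}. Orienting the path increasingly gives Φ = 0, orienting it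
-- alternately gives Φ = ⌊p/2⌋, and both DAGs extend to the whole tree, so it suffices that Φ changes by
-- at most one along an edge conv{c_A, c_B} of CIM_G. If Φ(B) ≥ Φ(A) + 2, a discrete intermediate value
-- argument finds a path edge ab, oriented alike in A and B, before which B has exactly one collider
-- more than A. Cutting the tree at ab and taking the parents on one side from A and on the other from B
-- (and vice versa) gives DAGs X and Y with skeleton G and c_X + c_Y = c_A + c_B, while Φ(X) and Φ(Y)
-- differ from Φ(A) and Φ(B). So the midpoint of the edge is the midpoint of two other generators of
-- CIM_G, which is impossible.

module Submission where

open import Defs
open import Data.Nat using (ℕ; _/_)

open import Algebra.Bundles using (CommutativeMonoid)
open import Data.Bool using (Bool; true; false; T; T?; _∧_; _∨_; not; if_then_else_)
import Data.Bool.Properties as Bool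
open import Data.Bool.ListAction using (any; all)
open import Data.Empty using (⊥; ⊥-elim)
open import Data.Fin as Fin using (Fin; _≟_; toℕ)
import Data.Fin.Properties as Fin
open import Data.Fin.Subset using (Subset; ∣_∣; ⁅_⁆) renaming (_∈_ to _∈ₛ_)
import Data.Fin.Subset as Subset
import Data.Fin.Subset.Properties as Subset
import Data.Integer as ℤ
open import Data.List as List using (List; []; _∷_; _++_; last; length; allFin; foldr; map)
import Data.List.Properties as List
open import Data.List.Membership.Propositional using (_∈_; lose; find)
open import Data.List.Membership.Propositional.Properties using (∈-++⁺ʳ; ∈-lookup; ∈-∃++; ∈-allFin)
open import Data.List.Relation.Unary.All as All using (All; []; _∷_)
open import Data.List.Relation.Unary.All.Properties using (All¬⇒¬Any; ¬Any⇒All¬)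
import Data.List.Relation.Unary.All.Properties as All
open import Data.List.Relation.Unary.Any using (here; there; satisfied; any?)
import Data.List.Relation.Unary.Any.Properties as Any
open import Data.List.Relation.Unary.Linked using (Linked; []; [-]; _∷_)
import Data.List.Relation.Unary.Linked as Lk
open import Data.List.Relation.Unary.Unique.Propositional using (Unique; []; _∷_)
open import Data.List.Relation.Unary.Unique.Propositional.Properties using (allFin⁺)
open import Data.Maybe using (just)
open import Data.Maybe.Properties using (just-injective)
open import Data.Nat using (zero; suc; _+_; _*_; _%_; _≤_; _<_; z≤n; s≤s; NonZero)
open import Data.Nat.DivMod using (m/n≡1+[m∸n]/n; [m+kn]%n≡m%n; m<n⇒m%n≡m)
open import Data.Nat.Properties renaming (_≟_ to _≟ℕ_)
open import Data.Product using (_×_; _,_; proj₁; proj₂; ∃-syntax)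
open import Data.Rational as ℚ using (ℚ; 0ℚ; 1ℚ)
import Data.Rational.Properties as ℚ
open import Data.Sum using (_⊎_; inj₁; inj₂; [_,_])
open import Data.Unit using (⊤; tt)
open import Data.Vec using (lookup; tabulate; []; _∷_)
import Data.Vec.Properties as Vec
open import Function using (_∘_; _∘′_)
open import Function.Bundles using (Equivalence; _⇔_; mk⇔)
open import Relation.Binary using (tri<; tri≈; tri>)
open import Relation.Binary.Definitions using (DecidableEquality)
open import Relation.Binary.PropositionalEquality as ≡
  using (_≡_; _≢_; refl; cong; cong₂; subst; subst₂; trans; module ≡-Reasoning)
open import Relation.Nullary using (¬_; Dec; yes; no)
open import Relation.Nullary.Decidable
  using (⌊_⌋; True; toWitness; fromWitness; toWitnessFalse; fromWitnessFalse; _×-dec_; _⊎-dec_; ¬?;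
         decidable-stable)

𝟙 : Bool → ℕ
𝟙 false = 0
𝟙 true  = 1

𝟙≤1 : ∀ b → 𝟙 b ≤ 1
𝟙≤1 false = z≤n
𝟙≤1 true  = ≤-refl

T-ext : ∀ {a b} → (T a → T b) → (T b → T a) → a ≡ b
T-ext {false} {false} _ _ = refl
T-ext {false} {true}  _ f = ⊥-elim (f _)
T-ext {true}  {false} f _ = ⊥-elim (f _)
T-ext {true}  {true}  _ _ = refl

≤-byDecision : ∀ {m k} {_ : True (m ≤? k)} → m ≤ k
≤-byDecision {_} {_} {m≤k} = toWitness m≤k

module _ {A : Set} where

  count : (A → Bool) → List A → ℕ
  count f []       = 0
  count f (x ∷ xs) = 𝟙 (f x) + count f xs

  count-unique : ∀ (f : A → Bool) {xs} → Unique xs → (∀ {x y} → T (f x) → T (f y) → x ≡ y) →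
                 count f xs ≡ 𝟙 (any f xs)
  count-unique f []                    atMostOne = refl
  count-unique f {x ∷ xs} (x∉xs ∷ uniq) atMostOne with f x in fx
  ... | false = count-unique f uniq atMostOne
  ... | true with any f xs in anyXs
  ...   | false = cong suc (trans (count-unique f uniq atMostOne) (cong 𝟙 anyXs))
  ...   | true  = ⊥-elim (All¬⇒¬Any onlyX (Any.any⁻ f xs (Equivalence.from Bool.T-≡ anyXs)))
    where
    onlyX : All (¬_ ∘ T ∘ f) xs
    onlyX = All.map (λ x≢y fy → x≢y (atMostOne (Equivalence.from Bool.T-≡ fx) fy)) x∉xs

  count-+ : ∀ {f g f′ g′ : A → Bool} xs → (∀ x → 𝟙 (f x) + 𝟙 (g x) ≡ 𝟙 (f′ x) + 𝟙 (g′ x)) →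
            count f xs + count g xs ≡ count f′ xs + count g′ xs
  count-+ []       _         = refl
  count-+ {f} {g} {f′} {g′} (x ∷ xs) pointwise = begin
    (𝟙 (f x) + count f xs) + (𝟙 (g x) + count g xs)
      ≡⟨ +-interchange (𝟙 (f x)) _ _ _ ⟩
    (𝟙 (f x) + 𝟙 (g x)) + (count f xs + count g xs)
      ≡⟨ cong₂ _+_ (pointwise x) (count-+ xs pointwise) ⟩
    (𝟙 (f′ x) + 𝟙 (g′ x)) + (count f′ xs + count g′ xs)
      ≡⟨ +-interchange (𝟙 (f′ x)) _ _ _ ⟩
    (𝟙 (f′ x) + count f′ xs) + (𝟙 (g′ x) + count g′ xs) ∎
    where
    open ≡-Reasoning
    open import Algebra.Properties.CommutativeSemigroup +-commutativeSemigroup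
      renaming (interchange to +-interchange)

  Linked₃ : (A → A → A → Set) → List A → Set
  Linked₃ P (x ∷ y ∷ z ∷ xs) = P x y z × Linked₃ P (y ∷ z ∷ xs)
  Linked₃ P _                = ⊤

  Linked₃-tail : ∀ {P : A → A → A → Set} {x} xs → Linked₃ P (x ∷ xs) → Linked₃ P xs
  Linked₃-tail []          _        = tt
  Linked₃-tail (_ ∷ [])    _        = tt
  Linked₃-tail (_ ∷ _ ∷ _) (_ , ps) = ps

  Linked₃-map : ∀ {P Q : A → A → A → Set} xs → (∀ {x y z} → P x y z → Q x y z) →
                Linked₃ P xs → Linked₃ Q xs
  Linked₃-map []               f _        = tt
  Linked₃-map (x ∷ [])         f _        = tt
  Linked₃-map (x ∷ y ∷ [])     f _        = tt
  Linked₃-map (x ∷ y ∷ z ∷ xs) f (p , ps) = f p , Linked₃-map (y ∷ z ∷ xs) f ps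

  Linked₃-∷ : ∀ {P : A → A → A → Set} {Q : A → Set} → (∀ {x y z} → Q y → P x y z) →
              ∀ x ys → All Q ys → Linked₃ P (x ∷ ys)
  Linked₃-∷ h x []           _          = tt
  Linked₃-∷ h x (y ∷ [])     _          = tt
  Linked₃-∷ h x (y ∷ z ∷ ys) (qy ∷ qys) = h qy , Linked₃-∷ h y (z ∷ ys) qys

  Linked₃-∷ʳ : ∀ {P : A → A → A → Set} {Q : A → Set} → (∀ {x y z} → Q y → P x y z) →
               ∀ xs z → All Q xs → Linked₃ P (xs ++ z ∷ [])
  Linked₃-∷ʳ h []               z _              = tt
  Linked₃-∷ʳ h (x ∷ [])         z _              = tt
  Linked₃-∷ʳ h (x ∷ y ∷ [])     z (_ ∷ qy ∷ _)   = h qy , tt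
  Linked₃-∷ʳ h (x ∷ y ∷ w ∷ xs) z (_ ∷ qy ∷ qws) = h qy , Linked₃-∷ʳ h (y ∷ w ∷ xs) z (qy ∷ qws)

  Linked₃-pairs : ∀ {R : A → A → Set} {xs} → Linked R xs → Linked₃ (λ x y z → R x y × R y z) xs
  Linked₃-pairs []            = tt
  Linked₃-pairs [-]           = tt
  Linked₃-pairs (_ ∷ [-])     = tt
  Linked₃-pairs (r ∷ r′ ∷ rs) = (r , r′) , Linked₃-pairs (r′ ∷ rs)

  colliderAfter : (A → A → Bool) → A → List A → ℕ
  colliderAfter f x (y ∷ z ∷ _) = 𝟙 (f x y ∧ f z y)
  colliderAfter f x _           = 0

  colliders : (A → A → Bool) → List A → ℕ
  colliders f []       = 0
  colliders f (x ∷ xs) = colliderAfter f x xs + colliders f xs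

  colliders-cong : ∀ {f g : A → A → Bool} xs → Linked₃ (λ x y z → (f x y ∧ f z y) ≡ (g x y ∧ g z y)) xs →
                   colliders f xs ≡ colliders g xs
  colliders-cong []               _        = refl
  colliders-cong (x ∷ [])         _        = refl
  colliders-cong (x ∷ y ∷ [])     _        = refl
  colliders-cong (x ∷ y ∷ z ∷ xs) (e , es) = cong₂ _+_ (cong 𝟙 e) (colliders-cong (y ∷ z ∷ xs) es)

  colliders-none : ∀ {f : A → A → Bool} xs → Linked₃ (λ x y z → ¬ T (f x y ∧ f z y)) xs → colliders f xs ≡ 0
  colliders-none []               _             = refl
  colliders-none (_ ∷ [])         _             = refl
  colliders-none (_ ∷ _ ∷ [])     _             = refl
  colliders-none (x ∷ y ∷ z ∷ xs) (none , rest) =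
    cong₂ _+_ (cong 𝟙 (Bool.¬-not (none ∘′ Equivalence.from Bool.T-≡))) (colliders-none (y ∷ z ∷ xs) rest)

  colliderAfter-++ : ∀ f x pre a b post →
                     colliderAfter f x (pre ++ a ∷ b ∷ post) ≡ colliderAfter f x (pre ++ a ∷ b ∷ [])
  colliderAfter-++ f x []          a b post = refl
  colliderAfter-++ f x (_ ∷ [])    a b post = refl
  colliderAfter-++ f x (_ ∷ _ ∷ _) a b post = refl

  colliders-split : ∀ f pre a b post → colliders f (pre ++ a ∷ b ∷ post) ≡
                    colliders f (pre ++ a ∷ b ∷ []) + colliders f (a ∷ b ∷ post)
  colliders-split f []        a b post = refl
  colliders-split f (x ∷ pre) a b post = begin
    colliderAfter f x (pre ++ a ∷ b ∷ post) + colliders f (pre ++ a ∷ b ∷ post)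
      ≡⟨ cong₂ _+_ (colliderAfter-++ f x pre a b post) (colliders-split f pre a b post) ⟩
    colliderAfter f x (pre ++ a ∷ b ∷ []) + (colliders f (pre ++ a ∷ b ∷ []) + colliders f (a ∷ b ∷ post))
      ≡⟨ +-assoc (colliderAfter f x (pre ++ a ∷ b ∷ [])) _ _ ⟨
    colliders f (x ∷ pre ++ a ∷ b ∷ []) + colliders f (a ∷ b ∷ post) ∎
    where open ≡-Reasoning

  EveryOtherCollider : (A → A → Bool) → List A → Set
  EveryOtherCollider f (x ∷ y ∷ z ∷ xs) = T (f x y ∧ f z y) × EveryOtherCollider f (z ∷ xs)
  EveryOtherCollider f _                = ⊤

  everyOther⇒colliders : ∀ {f : A → A → Bool} x xs → EveryOtherCollider f (x ∷ xs) →
                         length xs / 2 ≤ colliders f (x ∷ xs)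
  everyOther⇒colliders x []           _ = z≤n
  everyOther⇒colliders x (y ∷ [])     _ = z≤n
  everyOther⇒colliders {f} x (y ∷ z ∷ xs) (collider , rest) = begin
    length (y ∷ z ∷ xs) / 2
      ≡⟨ m/n≡1+[m∸n]/n {length (y ∷ z ∷ xs)} {2} (s≤s (s≤s z≤n)) ⟩
    1 + length xs / 2
      ≤⟨ s≤s (everyOther⇒colliders z xs rest) ⟩
    1 + colliders f (z ∷ xs)
      ≤⟨ s≤s (m≤n+m _ (colliderAfter f y (z ∷ xs))) ⟩
    1 + (colliderAfter f y (z ∷ xs) + colliders f (z ∷ xs))
      ≡⟨ cong (λ b → 𝟙 b + _) (Equivalence.to Bool.T-≡ collider) ⟨
    colliders f (x ∷ y ∷ z ∷ xs) ∎
    where open ≤-Reasoning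

module _ {A : Set} where

  Linked-++⁻ˡ : ∀ {R : A → A → Set} xs {ys} → Linked R (xs ++ ys) → Linked R xs
  Linked-++⁻ˡ []           _        = []
  Linked-++⁻ˡ (x ∷ [])     _        = [-]
  Linked-++⁻ˡ (x ∷ y ∷ xs) (r ∷ rs) = r ∷ Linked-++⁻ˡ (y ∷ xs) rs

  Linked-++⁻ʳ : ∀ {R : A → A → Set} xs {ys} → Linked R (xs ++ ys) → Linked R ys
  Linked-++⁻ʳ []       rs = rs
  Linked-++⁻ʳ (x ∷ xs) rs = Linked-++⁻ʳ xs (Lk.tail rs)

  Linked-last : ∀ {R : A → A → Set} x pre {y post} → Linked R (x ∷ pre ++ y ∷ post) →
                ∃[ z ] (last (x ∷ pre) ≡ just z × R z y)
  Linked-last x []        (r ∷ _)  = x , refl , r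
  Linked-last x (p ∷ pre) (_ ∷ rs) = Linked-last p pre rs

  Linked-map-All : ∀ {P : A → Set} {R S : A → A → Set} → (∀ {x y} → P x → P y → R x y → S x y) →
                   ∀ {xs} → All P xs → Linked R xs → Linked S xs
  Linked-map-All h []              []       = []
  Linked-map-All h (_ ∷ [])        [-]      = [-]
  Linked-map-All h (px ∷ py ∷ pxs) (r ∷ rs) = h px py r ∷ Linked-map-All h (py ∷ pxs) rs

  module _ {R : A → A → Set} {P : A → Set} where

    Linked-propagate : (∀ {j l} → R j l → P j → P l) → ∀ {x xs} → P x → Linked R (x ∷ xs) → All P (x ∷ xs)
    Linked-propagate next px [-]      = px ∷ []
    Linked-propagate next px (r ∷ rs) = px ∷ Linked-propagate next (next r px) rs

    Linked-propagate-back : (∀ {j l} → R j l → P l → P j) → ∀ {x xs y} →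
                            Linked R (x ∷ xs) → last (x ∷ xs) ≡ just y → P y → All P (x ∷ xs)
    Linked-propagate-back next [-]      refl py = py ∷ []
    Linked-propagate-back next (r ∷ rs) ends py with Linked-propagate-back next rs ends py
    ... | ps@(pz ∷ _) = next r pz ∷ ps

  constant-along : ∀ {B : Set} (σ : A → B) {xs x} → Linked (λ j l → σ j ≡ σ l) xs → x ∈ xs →
                   All (λ y → σ y ≡ σ x) xs
  constant-along σ [-]      (here refl) = refl ∷ []
  constant-along σ [-]      (there ())
  constant-along σ (e ∷ es) (here refl) =
    refl ∷ All.map (λ p → trans p (≡.sym e)) (constant-along σ es (here refl))
  constant-along σ (e ∷ es) (there x∈) with constant-along σ es x∈
  ... | ps@(p ∷ _) = trans e p ∷ ps

  Unique-++⁻ˡ : ∀ xs {ys : List A} → Unique (xs ++ ys) → Unique xs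
  Unique-++⁻ˡ []       _        = []
  Unique-++⁻ˡ (x ∷ xs) (x∉ ∷ u) = All.++⁻ˡ xs x∉ ∷ Unique-++⁻ˡ xs u

  Unique-++⁻ʳ : ∀ xs {ys : List A} → Unique (xs ++ ys) → Unique ys
  Unique-++⁻ʳ []       u       = u
  Unique-++⁻ʳ (x ∷ xs) (_ ∷ u) = Unique-++⁻ʳ xs u

  Unique-++-∉ : ∀ xs {y : A} {ys} → Unique (xs ++ y ∷ ys) → All (_≢ y) xs
  Unique-++-∉ []       _        = []
  Unique-++-∉ (x ∷ xs) (x∉ ∷ u) = All.lookup x∉ (∈-++⁺ʳ xs (here refl)) ∷ Unique-++-∉ xs u

  Unique-lookup-injective : ∀ {xs : List A} → Unique xs → ∀ {i j} → List.lookup xs i ≡ List.lookup xs j → i ≡ j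
  Unique-lookup-injective {x ∷ xs} (x∉ ∷ u) {Fin.zero}  {Fin.zero}  _ = refl
  Unique-lookup-injective {x ∷ xs} (x∉ ∷ u) {Fin.zero}  {Fin.suc j} e = ⊥-elim (All.lookup x∉ (∈-lookup j) e)
  Unique-lookup-injective {x ∷ xs} (x∉ ∷ u) {Fin.suc i} {Fin.zero}  e = ⊥-elim (All.lookup x∉ (∈-lookup i) (≡.sym e))
  Unique-lookup-injective {x ∷ xs} (x∉ ∷ u) {Fin.suc i} {Fin.suc j} e = cong Fin.suc (Unique-lookup-injective u e)

  NonBacktracking : List A → Set
  NonBacktracking = Linked₃ (λ x _ z → x ≢ z)

  nonBacktracking-reduce : DecidableEquality A → ∀ {R : A → A → Set} x ws → Linked R (x ∷ ws) →
    ∃[ rs ] (Linked R (x ∷ rs) × NonBacktracking (x ∷ rs) × last (x ∷ rs) ≡ last (x ∷ ws))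
  nonBacktracking-reduce _≟ₐ_ x []       _        = [] , [-] , tt , refl
  nonBacktracking-reduce _≟ₐ_ x (y ∷ ws) (r ∷ rs) with nonBacktracking-reduce _≟ₐ_ y ws rs
  ... | []     , _   , _  , ends = y ∷ [] , r ∷ [-] , tt , ends
  ... | z ∷ zs , rs′ , nb , ends with x ≟ₐ z
  ...   | no  x≢z  = y ∷ z ∷ zs , r ∷ rs′ , (x≢z , nb) , ends
  ...   | yes refl = zs , Lk.tail rs′ , Linked₃-tail (z ∷ zs) nb , ends

Unique⇒length≤ : ∀ {n} {xs : List (Fin n)} → Unique xs → length xs ≤ n
Unique⇒length≤ {n} {xs} u with length xs ≤? n
... | yes ≤n = ≤n
... | no  ≰n with i , j , i<j , same ← Fin.pigeonhole (≰⇒> ≰n) (List.lookup xs) =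
  ⊥-elim (Fin.<-irrefl (Unique-lookup-injective u same) i<j)

-- A discrete intermediate value argument for two orientations of a list

Orientation : {A : Set} → (A → A → Bool) → A → A → Set
Orientation h x y = h y x ≡ not (h x y)

pending : Bool → Bool → ℕ
pending α β = 𝟙 (not α ∧ β)

pending-agree : ∀ α α′ β′ → 𝟙 (α ∧ not β′) + pending α′ β′ ≤ 𝟙 (α ∧ not α′) + 1
pending-agree false false false = ≤-byDecision
pending-agree false false true  = ≤-byDecision
pending-agree false true  false = ≤-byDecision
pending-agree false true  true  = ≤-byDecision
pending-agree true  false false = ≤-byDecision
pending-agree true  false true  = ≤-byDecision
pending-agree true  true  false = ≤-byDecision
pending-agree true  true  true  = ≤-byDecision

pending-disagree : ∀ α α′ β′ → 𝟙 (not α ∧ not β′) + pending α′ β′ ≤ pending α (not α) + 𝟙 (α ∧ not α′)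
pending-disagree false false false = ≤-byDecision
pending-disagree false false true  = ≤-byDecision
pending-disagree false true  false = ≤-byDecision
pending-disagree false true  true  = ≤-byDecision
pending-disagree true  false false = ≤-byDecision
pending-disagree true  false true  = ≤-byDecision
pending-disagree true  true  false = ≤-byDecision
pending-disagree true  true  true  = ≤-byDecision

module _ {A : Set} (f g : A → A → Bool) where

  -- c and d are the numbers of colliders of f and g already counted before the list xs.
  record EdgeAhead (c d : ℕ) (xs : List A) : Set where
    constructor edgeAhead
    field
      pre      : List A
      a b      : A
      post     : List A
      splits   : xs ≡ pre ++ a ∷ b ∷ post
      agrees   : f a b ≡ g a b
      oneAhead : d + colliders g (pre ++ a ∷ b ∷ []) ≡ 1 + c + colliders f (pre ++ a ∷ b ∷ [])

  EdgeAhead-∷ : ∀ {c d} x xs → EdgeAhead (c + colliderAfter f x xs) (d + colliderAfter g x xs) xs →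
                EdgeAhead c d (x ∷ xs)
  EdgeAhead-∷ {c} {d} x xs (edgeAhead pre a b post refl agrees oneAhead) =
    edgeAhead (x ∷ pre) a b post refl agrees (begin
      d + (colliderAfter g x P + colliders g P)       ≡⟨ cong (λ h → d + (h + colliders g P)) (after g) ⟩
      d + (colliderAfter g x xs + colliders g P)      ≡⟨ +-assoc d _ _ ⟨
      d + colliderAfter g x xs + colliders g P        ≡⟨ oneAhead ⟩
      1 + c + colliderAfter f x xs + colliders f P    ≡⟨ +-assoc (1 + c) _ _ ⟩
      1 + c + (colliderAfter f x xs + colliders f P)  ≡⟨ cong (λ h → 1 + c + (h + colliders f P)) (after f) ⟨
      1 + c + (colliderAfter f x P + colliders f P)   ∎)
    where
    open ≡-Reasoning
    P = pre ++ a ∷ b ∷ []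
    after : ∀ h → colliderAfter h x P ≡ colliderAfter h x (pre ++ a ∷ b ∷ post)
    after h = ≡.sym (colliderAfter-++ h x pre a b post)

  shift-first-collider : ∀ {c d x y z zs} →
    2 + c + colliders f (x ∷ y ∷ z ∷ zs) ≤ d + colliders g (x ∷ y ∷ z ∷ zs) →
    2 + (c + colliderAfter f x (y ∷ z ∷ zs)) + colliders f (y ∷ z ∷ zs) ≤
      d + colliderAfter g x (y ∷ z ∷ zs) + colliders g (y ∷ z ∷ zs)
  shift-first-collider {c} {d} {x} {y} {z} {zs} =
    subst₂ _≤_ (≡.sym (+-assoc (2 + c) (colliderAfter f x (y ∷ z ∷ zs)) _))
               (≡.sym (+-assoc d (colliderAfter g x (y ∷ z ∷ zs)) _))

  collider-step-agree : ∀ {x y z} → f x y ≡ g x y → Orientation f y z → Orientation g y z →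
    colliderAfter g x (y ∷ z ∷ []) + pending (f y z) (g y z) ≤ colliderAfter f x (y ∷ z ∷ []) + 1
  collider-step-agree {x} {y} {z} agree fyz gyz rewrite fyz | gyz | agree =
    pending-agree (g x y) (f y z) (g y z)

  collider-step-disagree : ∀ {x y z} → g x y ≡ not (f x y) → Orientation f y z → Orientation g y z →
    colliderAfter g x (y ∷ z ∷ []) + pending (f y z) (g y z) ≤
      pending (f x y) (g x y) + colliderAfter f x (y ∷ z ∷ [])
  collider-step-disagree {x} {y} {z} opposite fyz gyz rewrite fyz | gyz | opposite =
    pending-disagree (f x y) (f y z) (g y z)

  pending-step : ∀ {c d x y z} → Orientation f y z → Orientation g y z → d + pending (f x y) (g x y) ≤ 1 + c →
    (f x y ≡ g x y × d ≡ 1 + c) ⊎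
    (d + colliderAfter g x (y ∷ z ∷ []) + pending (f y z) (g y z) ≤ 1 + (c + colliderAfter f x (y ∷ z ∷ [])))
  pending-step {c} {d} {x} {y} {z} fyz gyz inv with f x y Bool.≟ g x y
  ... | no disagree = inj₂ (begin
    d + colliderAfter g x (y ∷ z ∷ []) + pending (f y z) (g y z)
      ≡⟨ +-assoc d _ _ ⟩
    d + (colliderAfter g x (y ∷ z ∷ []) + pending (f y z) (g y z))
      ≤⟨ +-monoʳ-≤ d (collider-step-disagree (Bool.¬-not (disagree ∘′ ≡.sym)) fyz gyz) ⟩
    d + (pending (f x y) (g x y) + colliderAfter f x (y ∷ z ∷ []))
      ≡⟨ +-assoc d _ _ ⟨
    d + pending (f x y) (g x y) + colliderAfter f x (y ∷ z ∷ [])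
      ≤⟨ +-monoˡ-≤ _ inv ⟩
    1 + (c + colliderAfter f x (y ∷ z ∷ [])) ∎)
    where open ≤-Reasoning
  ... | yes agree with d ≟ℕ 1 + c
  ...   | yes d≡1+c = inj₁ (agree , d≡1+c)
  ...   | no  d≢1+c = inj₂ (begin
    d + colliderAfter g x (y ∷ z ∷ []) + pending (f y z) (g y z)
      ≡⟨ +-assoc d _ _ ⟩
    d + (colliderAfter g x (y ∷ z ∷ []) + pending (f y z) (g y z))
      ≤⟨ +-mono-≤ d≤c (collider-step-agree agree fyz gyz) ⟩
    c + (colliderAfter f x (y ∷ z ∷ []) + 1)
      ≡⟨ +-assoc c _ 1 ⟨
    c + colliderAfter f x (y ∷ z ∷ []) + 1
      ≡⟨ +-comm _ 1 ⟩
    1 + (c + colliderAfter f x (y ∷ z ∷ [])) ∎)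
    where
    open ≤-Reasoning
    d≤c : d ≤ c
    d≤c = ≤-pred (≤∧≢⇒< (≤-trans (m≤m+n d _) inv) d≢1+c)

  -- pending (f x y) (g x y) = 1 when g orients xy forwards and f backwards, so that g may gain a
  -- collider at y which f cannot. The invariant d + pending ≤ 1 + c holds at the first edge; when
  -- g has gained two colliders on f it must have passed an agreeing edge with d = 1 + c.
  edge-ahead : ∀ c d x y zs →
               Linked (Orientation f) (x ∷ y ∷ zs) → Linked (Orientation g) (x ∷ y ∷ zs) →
               d + pending (f x y) (g x y) ≤ 1 + c →
               2 + c + colliders f (x ∷ y ∷ zs) ≤ d + colliders g (x ∷ y ∷ zs) →
               EdgeAhead c d (x ∷ y ∷ zs)
  edge-ahead c d x y [] _ _ inv big = ⊥-elim (n≮n (1 + c) (begin-strict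
    1 + c                         <⟨ n<1+n (1 + c) ⟩
    2 + c                         ≡⟨ +-identityʳ (2 + c) ⟨
    2 + c + 0                     ≤⟨ big ⟩
    d + 0                         ≤⟨ +-monoʳ-≤ d z≤n ⟩
    d + pending (f x y) (g x y)   ≤⟨ inv ⟩
    1 + c                         ∎))
    where open ≤-Reasoning
  edge-ahead c d x y (z ∷ zs) (_ ∷ fs) (_ ∷ gs) inv big with pending-step (Lk.head fs) (Lk.head gs) inv
  ... | inj₁ (agree , d≡1+c) = edgeAhead [] x y (z ∷ zs) refl agree (cong (_+ 0) d≡1+c)
  ... | inj₂ inv′ = EdgeAhead-∷ x (y ∷ z ∷ zs)
    (edge-ahead (c + colliderAfter f x (y ∷ z ∷ zs)) (d + colliderAfter g x (y ∷ z ∷ zs)) y z zs fs gs inv′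
                (shift-first-collider {c} {d} {x} {y} {z} {zs} big))

  edge-ahead-of-two : ∀ xs → Linked (Orientation f) xs → Linked (Orientation g) xs →
                      2 + colliders f xs ≤ colliders g xs → EdgeAhead 0 0 xs
  edge-ahead-of-two (x ∷ y ∷ zs) fs gs big = edge-ahead 0 0 x y zs fs gs (𝟙≤1 (not (f x y) ∧ g x y)) big

module _ {n : ℕ} where

  -- imsetBool D S is by definition any (isSinkOf D S) (allFin n).
  isSinkOf : Digraph n → Subset n → Fin n → Bool
  isSinkOf D S i = lookup S i ∧ all (λ j → not (lookup S j) ∨ ⌊ j ≟ i ⌋ ∨ arrow D j i) (allFin n)

  IsSinkOf : Digraph n → Subset n → Fin n → Set
  IsSinkOf D S i = T (lookup S i) × (∀ j → T (lookup S j) → j ≢ i → Arr D j i)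

  isSinkOf-sound : ∀ {D S i} → T (isSinkOf D S i) → IsSinkOf D S i
  isSinkOf-sound {D} {S} {i} t =
    let i∈S , others = Equivalence.to Bool.T-∧ t
    in i∈S , λ j j∈S j≢i → parent j∈S j≢i (All.lookup (All.all⁺ _ (allFin n) others) (∈-allFin j))
    where
    parent : ∀ {j} → T (lookup S j) → j ≢ i → T (not (lookup S j) ∨ ⌊ j ≟ i ⌋ ∨ arrow D j i) →
             Arr D j i
    parent {j} j∈S j≢i ok with lookup S j | j ≟ i
    ... | true | no _     = ok
    ... | true | yes j≡i  = ⊥-elim (j≢i j≡i)

  isSinkOf-complete : ∀ {D S i} → IsSinkOf D S i → T (isSinkOf D S i)
  isSinkOf-complete {D} {S} {i} (i∈S , parents) =
    Equivalence.from Bool.T-∧ (i∈S , All.all⁻ _ {xs = allFin n} (All.tabulate (λ {j} _ → ok j)))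
    where
    ok : ∀ j → T (not (lookup S j) ∨ ⌊ j ≟ i ⌋ ∨ arrow D j i)
    ok j with lookup S j in j∈S | j ≟ i
    ... | false | _       = _
    ... | true  | yes _   = _
    ... | true  | no j≢i  = parents j (Equivalence.from Bool.T-≡ j∈S) j≢i

  NoDigon : Digraph n → Set
  NoDigon D = ∀ {i j} → Arr D i j → Arr D j i → ⊥

  dag⇒noDigon : ∀ {D} → IsDAG D → NoDigon D
  dag⇒noDigon dag {i} {j} ij ji = dag (i ∷ j ∷ []) ((ij ∷ [-]) , j , refl , ji)

  reverse-false : ∀ {D i j} → NoDigon D → Arr D i j → arrow D j i ≡ false
  reverse-false noDigon i→j = Bool.¬-not (noDigon i→j ∘′ Equivalence.from Bool.T-≡)

  sink-unique : ∀ {D S i k} → NoDigon D → IsSinkOf D S i → IsSinkOf D S k → i ≡ k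
  sink-unique {i = i} {k} noDigon (i∈S , toI) (k∈S , toK) with i ≟ k
  ... | yes i≡k = i≡k
  ... | no  i≢k = ⊥-elim (noDigon (toK i i∈S i≢k) (toI k k∈S (λ k≡i → i≢k (≡.sym k≡i))))

  imset-count : ∀ {D} S → NoDigon D → count (isSinkOf D S) (allFin n) ≡ 𝟙 (imsetBool D S)
  imset-count {D} S noDigon = count-unique (isSinkOf D S) (allFin⁺ n)
    (λ si sk → sink-unique {D} {S} noDigon (isSinkOf-sound {D} {S} si) (isSinkOf-sound {D} {S} sk))

  mix : (Fin n → Bool) → Digraph n → Digraph n → Digraph n
  arrow (mix σ P Q) j i = if σ i then arrow P j i else arrow Q j i

  isSinkOf-mix : ∀ σ P Q S i →
                 isSinkOf (mix σ P Q) S i ≡ (if σ i then isSinkOf P S i else isSinkOf Q S i)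
  isSinkOf-mix σ P Q S i with σ i
  ... | true  = refl
  ... | false = refl

  imset-mix : ∀ σ P Q S → NoDigon P → NoDigon Q → NoDigon (mix σ P Q) → NoDigon (mix σ Q P) →
              𝟙 (imsetBool (mix σ P Q) S) + 𝟙 (imsetBool (mix σ Q P) S) ≡
              𝟙 (imsetBool P S) + 𝟙 (imsetBool Q S)
  imset-mix σ P Q S noP noQ noPQ noQP = begin
    𝟙 (imsetBool (mix σ P Q) S) + 𝟙 (imsetBool (mix σ Q P) S)
      ≡⟨ cong₂ _+_ (imset-count S noPQ) (imset-count S noQP) ⟨
    count (isSinkOf (mix σ P Q) S) (allFin n) + count (isSinkOf (mix σ Q P) S) (allFin n)
      ≡⟨ count-+ (allFin n) sinks ⟩
    count (isSinkOf P S) (allFin n) + count (isSinkOf Q S) (allFin n)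
      ≡⟨ cong₂ _+_ (imset-count S noP) (imset-count S noQ) ⟩
    𝟙 (imsetBool P S) + 𝟙 (imsetBool Q S) ∎
    where
    open ≡-Reasoning
    sinks : ∀ i → 𝟙 (isSinkOf (mix σ P Q) S i) + 𝟙 (isSinkOf (mix σ Q P) S i) ≡
                  𝟙 (isSinkOf P S i) + 𝟙 (isSinkOf Q S i)
    sinks i rewrite isSinkOf-mix σ P Q S i | isSinkOf-mix σ Q P S i with σ i
    ... | true  = refl
    ... | false = +-comm (𝟙 (isSinkOf Q S i)) (𝟙 (isSinkOf P S i))

indicatorℚ : Bool → ℚ
indicatorℚ b = if b then 1ℚ else 0ℚ

indicatorℚ-pair : ∀ a b → indicatorℚ a ℚ.+ indicatorℚ b ≡ ℤ.+ (𝟙 a + 𝟙 b) ℚ./ 1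
indicatorℚ-pair false false = refl
indicatorℚ-pair false true  = refl
indicatorℚ-pair true  false = refl
indicatorℚ-pair true  true  = refl

indicatorℚ-+ : ∀ a b c d → 𝟙 a + 𝟙 b ≡ 𝟙 c + 𝟙 d →
               indicatorℚ a ℚ.+ indicatorℚ b ≡ indicatorℚ c ℚ.+ indicatorℚ d
indicatorℚ-+ a b c d e =
  trans (indicatorℚ-pair a b) (trans (cong (λ k → ℤ.+ k ℚ./ 1) e) (≡.sym (indicatorℚ-pair c d)))

indicatorℚ-injective : ∀ {a b} → indicatorℚ a ≡ indicatorℚ b → a ≡ b
indicatorℚ-injective {false} {false} _ = refl
indicatorℚ-injective {true}  {true}  _ = refl

charImset-mix : ∀ {n} σ (P Q : Digraph n) S →
                NoDigon P → NoDigon Q → NoDigon (mix σ P Q) → NoDigon (mix σ Q P) →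
                charImset (mix σ P Q) S ℚ.+ charImset (mix σ Q P) S ≡ charImset P S ℚ.+ charImset Q S
charImset-mix σ P Q S noP noQ noPQ noQP =
  indicatorℚ-+ (imsetBool (mix σ P Q) S) (imsetBool (mix σ Q P) S) (imsetBool P S) (imsetBool Q S)
    (imset-mix σ P Q S noP noQ noPQ noQP)

module _ {n : ℕ} (G : Graph n) where

  adj-irrefl : ∀ {x} → ¬ Adj G x x
  adj-irrefl {x} = subst T (irrefl G x)

  adj-sym : ∀ {x y} → Adj G x y → Adj G y x
  adj-sym {x} {y} = subst T (sym G x y)

  DAGWithSkeleton : Digraph n → Set
  DAGWithSkeleton D = IsDAG D × HasSkeleton D G

  arrow⇒adj : ∀ {D i j} → HasSkeleton D G → Arr D i j → Adj G i j
  arrow⇒adj sk ij = Equivalence.from (sk _ _) (inj₁ ij)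

  skeleton-orientation : ∀ {D i j} → HasSkeleton D G → NoDigon D → Adj G i j →
                         Orientation (arrow D) i j
  skeleton-orientation {D} {i} {j} sk noDigon ij with arrow D i j in eij | arrow D j i in eji
  ... | true  | true  = ⊥-elim (noDigon (Equivalence.from Bool.T-≡ eij) (Equivalence.from Bool.T-≡ eji))
  ... | true  | false = refl
  ... | false | true  = refl
  ... | false | false with Equivalence.to (sk i j) ij
  ...   | inj₁ i→j = ⊥-elim (subst T eij i→j)
  ...   | inj₂ j→i = ⊥-elim (subst T eji j→i)

  ¬adj⇒arrow≡false : ∀ {D j l} → HasSkeleton D G → ¬ Adj G j l → arrow D j l ≡ false
  ¬adj⇒arrow≡false sk j≁l = Bool.¬-not (j≁l ∘′ arrow⇒adj sk ∘′ Equivalence.from Bool.T-≡)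

  PathTriple : Fin n → Fin n → Fin n → Set
  PathTriple x y z = Adj G x y × Adj G y z × x ≢ z

  path-triples : ∀ {xs} → IsPath G xs → Linked₃ PathTriple xs
  path-triples {[]}             _                                   = tt
  path-triples {_ ∷ []}         _                                   = tt
  path-triples {_ ∷ _ ∷ []}     _                                   = tt
  path-triples {x ∷ y ∷ z ∷ xs} ((_ ∷ x≢z ∷ _) ∷ unique , xy ∷ walk) =
    (xy , Lk.head walk , x≢z) , path-triples (unique , walk)

module Mixing {n : ℕ} (σ : Fin n → Bool) (P Q : Digraph n) where

  X : Digraph n
  X = mix σ P Q

  mix-arrow : ∀ {x y s} → σ y ≡ s → arrow X x y ≡ arrow (if s then P else Q) x y
  mix-arrow {x} {y} refl = ≡.sym (Bool.if-float (λ D → arrow D x y) (σ y))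

  true-side-backward-closed : (∀ {j l} → σ j ≡ false → σ l ≡ true → ¬ Arr P j l) →
                              ∀ {j l} → Arr X j l → σ l ≡ true → σ j ≡ true
  true-side-backward-closed noEntry {j} j→l σl with σ j in σj
  ... | true  = refl
  ... | false = ⊥-elim (noEntry σj σl (subst T (mix-arrow σl) j→l))

  mix-dag : IsDAG P → IsDAG Q → (∀ {j l} → σ j ≡ false → σ l ≡ true → ¬ Arr P j l) →
            IsDAG X
  mix-dag dagP dagQ noEntry (x ∷ xs) (chain , y , ends , y→x) = onSide (σ x) refl
    where
    descend : ∀ {j l} → Arr X j l → σ j ≡ false → σ l ≡ false
    descend j→l σj = Bool.¬-not (λ σl → Bool.not-¬ σj (true-side-backward-closed noEntry j→l σl))
    onSide : ∀ b → σ x ≡ b → ⊥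
    onSide true σx = dagP (x ∷ xs) (Linked-map-All (λ _ σl → subst T (mix-arrow σl)) allTrue chain ,
                                    y , ends , subst T (mix-arrow σx) y→x)
      where
      allTrue : All (λ v → σ v ≡ true) (x ∷ xs)
      allTrue = Linked-propagate-back (true-side-backward-closed noEntry) chain ends
                  (true-side-backward-closed noEntry y→x σx)
    onSide false σx = dagQ (x ∷ xs) (Linked-map-All (λ _ σl → subst T (mix-arrow σl)) allFalse chain ,
                                     y , ends , subst T (mix-arrow σx) y→x)
      where
      allFalse : All (λ v → σ v ≡ false) (x ∷ xs)
      allFalse = Linked-propagate descend σx chain

  skeleton-transfer : ∀ {G D i j} → arrow X i j ≡ arrow D i j → arrow X j i ≡ arrow D j i →
                      (Adj G i j ⇔ (Arr D i j ⊎ Arr D j i)) → (Adj G i j ⇔ (Arr X i j ⊎ Arr X j i))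
  skeleton-transfer {G} {i = i} {j} eij eji =
    subst₂ (λ b c → Adj G i j ⇔ (T b ⊎ T c)) (≡.sym eij) (≡.sym eji)

  mix-skeleton : ∀ G → HasSkeleton P G → HasSkeleton Q G →
                 (∀ {j l} → σ j ≢ σ l → arrow P j l ≡ arrow Q j l) → HasSkeleton X G
  mix-skeleton G skP skQ crossAgree i j with σ i Bool.≟ σ j
  ... | yes same =
    skeleton-transfer {G} {if σ j then P else Q} {i} {j} (mix-arrow refl) (mix-arrow same) (skeleton-if (σ j) i j)
    where
    skeleton-if : ∀ s → HasSkeleton (if s then P else Q) G
    skeleton-if true  = skP
    skeleton-if false = skQ
  ... | no differ =
    skeleton-transfer {G} {P} {i} {j} (cross-arrow differ) (cross-arrow (differ ∘′ ≡.sym)) (skP i j)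
    where
    cross-arrow : ∀ {j l} → σ j ≢ σ l → arrow X j l ≡ arrow P j l
    cross-arrow {j} {l} differ with σ l in σl
    ... | true  = refl
    ... | false = ≡.sym (crossAgree (λ σj≡σl → differ (trans σj≡σl σl)))

  colliders-mix-∷ : ∀ {s} e M → All (λ y → σ y ≡ s) M →
                    colliders (arrow X) (e ∷ M) ≡ colliders (arrow (if s then P else Q)) (e ∷ M)
  colliders-mix-∷ e M onSide =
    colliders-cong (e ∷ M) (Linked₃-∷ (λ σy → cong₂ _∧_ (mix-arrow σy) (mix-arrow σy)) e M onSide)

  colliders-mix-∷ʳ : ∀ {s} M e → All (λ y → σ y ≡ s) M →
                     colliders (arrow X) (M ++ e ∷ []) ≡
                     colliders (arrow (if s then P else Q)) (M ++ e ∷ [])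
  colliders-mix-∷ʳ M e onSide =
    colliders-cong (M ++ e ∷ [])
      (Linked₃-∷ʳ (λ σy → cong₂ _∧_ (mix-arrow σy) (mix-arrow σy)) M e onSide)

module _ {A : Set} where

  sumℚ : (A → ℚ) → List A → ℚ
  sumℚ f xs = foldr ℚ._+_ 0ℚ (map f xs)

  sumℚ-+ : ∀ {f g f′ g′ : A → ℚ} xs → (∀ x → f x ℚ.+ g x ≡ f′ x ℚ.+ g′ x) →
           sumℚ f xs ℚ.+ sumℚ g xs ≡ sumℚ f′ xs ℚ.+ sumℚ g′ xs
  sumℚ-+ []       _         = refl
  sumℚ-+ {f} {g} {f′} {g′} (x ∷ xs) pointwise = begin
    (f x ℚ.+ sumℚ f xs) ℚ.+ (g x ℚ.+ sumℚ g xs)       ≡⟨ interchange (f x) _ _ _ ⟩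
    (f x ℚ.+ g x) ℚ.+ (sumℚ f xs ℚ.+ sumℚ g xs)       ≡⟨ cong₂ ℚ._+_ (pointwise x) (sumℚ-+ xs pointwise) ⟩
    (f′ x ℚ.+ g′ x) ℚ.+ (sumℚ f′ xs ℚ.+ sumℚ g′ xs)   ≡⟨ interchange (f′ x) _ _ _ ⟩
    (f′ x ℚ.+ sumℚ f′ xs) ℚ.+ (g′ x ℚ.+ sumℚ g′ xs)   ∎
    where
    open ≡-Reasoning
    open import Algebra.Properties.CommutativeSemigroup
      (CommutativeMonoid.commutativeSemigroup ℚ.+-0-commutativeMonoid) using (interchange)

  sumℚ-mono-≤ : ∀ {f g : A → ℚ} xs → (∀ x → f x ℚ.≤ g x) → sumℚ f xs ℚ.≤ sumℚ g xs
  sumℚ-mono-≤ []       _  = ℚ.≤-refl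
  sumℚ-mono-≤ (x ∷ xs) f≤g = ℚ.+-mono-≤ (f≤g x) (sumℚ-mono-≤ xs f≤g)

  sumℚ-mono-< : ∀ {f g : A → ℚ} {xs x} → (∀ x → f x ℚ.≤ g x) → x ∈ xs → f x ℚ.< g x →
                sumℚ f xs ℚ.< sumℚ g xs
  sumℚ-mono-< {xs = _ ∷ xs} f≤g (here refl) f<g = ℚ.+-mono-<-≤ f<g (sumℚ-mono-≤ xs f≤g)
  sumℚ-mono-< {xs = y ∷ _}  f≤g (there x∈)  f<g = ℚ.+-mono-≤-< (f≤g y) (sumℚ-mono-< f≤g x∈ f<g)

∈-allSubsets : ∀ {n} (S : Subset n) → S ∈ allSubsets n
∈-allSubsets []      = here refl
∈-allSubsets (b ∷ S) = extend b (allSubsets _) (∈-allSubsets S)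
  where
  extend : ∀ {m} {S : Subset m} b Ss → S ∈ Ss →
           (b ∷ S) ∈ foldr (λ S′ acc → (true ∷ S′) ∷ (false ∷ S′) ∷ acc) [] Ss
  extend true  (_ ∷ Ss) (here refl) = here refl
  extend false (_ ∷ Ss) (here refl) = there (here refl)
  extend b     (_ ∷ Ss) (there S∈)  = there (there (extend b Ss S∈))

ℚ-≤-byDecision : ∀ {p q} {_ : True (p ℚ.≤? q)} → p ℚ.≤ q
ℚ-≤-byDecision {_} {_} {p≤q} = toWitness p≤q

ℚ-<-byDecision : ∀ {p q} {_ : True (p ℚ.<? q)} → p ℚ.< q
ℚ-<-byDecision {_} {_} {p<q} = toWitness p<q

signℚ : Bool → ℚ
signℚ b = if b then 1ℚ else ℚ.- 1ℚ

sign-indicator-≤ : ∀ b b′ → signℚ b ℚ.* indicatorℚ b′ ℚ.≤ signℚ b ℚ.* indicatorℚ b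
sign-indicator-≤ false false = ℚ-≤-byDecision
sign-indicator-≤ false true  = ℚ-≤-byDecision
sign-indicator-≤ true  false = ℚ-≤-byDecision
sign-indicator-≤ true  true  = ℚ-≤-byDecision

sign-indicator-< : ∀ {b b′} → b′ ≢ b → signℚ b ℚ.* indicatorℚ b′ ℚ.< signℚ b ℚ.* indicatorℚ b
sign-indicator-< {false} {false} ne = ⊥-elim (ne refl)
sign-indicator-< {false} {true}  _  = ℚ-<-byDecision
sign-indicator-< {true}  {false} _  = ℚ-<-byDecision
sign-indicator-< {true}  {true}  ne = ⊥-elim (ne refl)

module _ {n : ℕ} where

  term : Point n → Point n → Subset n → ℚ
  term w x S = if ⌊ 2 ≤? ∣ S ∣ ⌋ then w S ℚ.* x S else 0ℚ

  dot-+ : ∀ w {x y x′ y′ : Point n} → (∀ S → 2 ≤ ∣ S ∣ → x S ℚ.+ y S ≡ x′ S ℚ.+ y′ S) →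
          dot w x ℚ.+ dot w y ≡ dot w x′ ℚ.+ dot w y′
  dot-+ w {x} {y} {x′} {y′} same = sumℚ-+ (allSubsets n) pointwise
    where
    pointwise : ∀ S → term w x S ℚ.+ term w y S ≡ term w x′ S ℚ.+ term w y′ S
    pointwise S with 2 ≤? ∣ S ∣
    ... | no  _   = refl
    ... | yes big = begin
      w S ℚ.* x S ℚ.+ w S ℚ.* y S     ≡⟨ ℚ.*-distribˡ-+ (w S) (x S) (y S) ⟨
      w S ℚ.* (x S ℚ.+ y S)           ≡⟨ cong (w S ℚ.*_) (same S big) ⟩
      w S ℚ.* (x′ S ℚ.+ y′ S)         ≡⟨ ℚ.*-distribˡ-+ (w S) (x′ S) (y′ S) ⟩
      w S ℚ.* x′ S ℚ.+ w S ℚ.* y′ S   ∎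
      where open ≡-Reasoning

  imsetFunctional : Digraph n → Point n
  imsetFunctional D S = signℚ (imsetBool D S)

  imsetFunctional-strictMax : ∀ D D′ (x : Point n) → x ≈P charImset D′ → ¬ x ≈P charImset D →
                          dot (imsetFunctional D) x ℚ.< dot (imsetFunctional D) (charImset D)
  imsetFunctional-strictMax D D′ x x≈D′ x≉D
    with any? (λ S → 2 ≤? ∣ S ∣ ×-dec ¬? (imsetBool D′ S Bool.≟ imsetBool D S)) (allSubsets n)
  ... | yes differs =
    let S , S∈ , big , D′≢D = find differs
    in sumℚ-mono-< termwise S∈ (strict S big D′≢D)
    where
    termwise : ∀ S → term (imsetFunctional D) x S ℚ.≤ term (imsetFunctional D) (charImset D) S
    termwise S with 2 ≤? ∣ S ∣
    ... | no  _   = ℚ.≤-refl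
    ... | yes big rewrite x≈D′ S big = sign-indicator-≤ (imsetBool D S) (imsetBool D′ S)
    strict : ∀ S → 2 ≤ ∣ S ∣ → imsetBool D′ S ≢ imsetBool D S →
             term (imsetFunctional D) x S ℚ.< term (imsetFunctional D) (charImset D) S
    strict S big D′≢D with 2 ≤? ∣ S ∣
    ... | no  small = ⊥-elim (small big)
    ... | yes _ rewrite x≈D′ S big = sign-indicator-< D′≢D
  ... | no agree = ⊥-elim (x≉D (λ S big → trans (x≈D′ S big) (cong indicatorℚ (same S big))))
    where
    same : ∀ S → 2 ≤ ∣ S ∣ → imsetBool D′ S ≡ imsetBool D S
    same S big = decidable-stable (imsetBool D′ S Bool.≟ imsetBool D S)
                   (λ D′≢D → agree (lose (∈-allSubsets S) (big , D′≢D)))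

  edge-midpoint : ∀ {G : Graph n} {u v x y} → IsEdge G u v → IsGenerator G x → IsGenerator G y →
                  (∀ S → 2 ≤ ∣ S ∣ → x S ℚ.+ y S ≡ u S ℚ.+ v S) →
                  ¬ x ≈P u → ¬ x ≈P v → ¬ y ≈P u → ¬ y ≈P v → ⊥
  edge-midpoint {u = u} {v} {x} {y} (_ , _ , _ , w , wu≡wv , below) genX genY midpoint
                x≉u x≉v y≉u y≉v =
    ℚ.<-irrefl sums (ℚ.+-mono-< (below x genX x≉u x≉v) (below y genY y≉u y≉v))
    where
    sums : dot w x ℚ.+ dot w y ≡ dot w u ℚ.+ dot w u
    sums = trans (dot-+ w midpoint) (cong (dot w u ℚ.+_) (≡.sym wu≡wv))

module _ {n : ℕ} (G : Graph n) where

  imset-generator : ∀ {D} → DAGWithSkeleton G D → IsGenerator G (charImset D)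
  imset-generator {D} (dag , sk) = D , dag , sk , λ _ _ → refl

  imset-vertex : ∀ D → DAGWithSkeleton G D → IsVertex G (charImset D)
  imset-vertex D D-ok = imset-generator D-ok , imsetFunctional D ,
    λ { x (D′ , _ , _ , x≈D′) x≉D → imsetFunctional-strictMax D D′ x x≈D′ x≉D }

-- Colliders are coordinates of the characteristic imset

module _ {n : ℕ} where

  two-members⇒2≤∣∣ : ∀ {S : Subset n} {x y} → x ∈ₛ S → y ∈ₛ S → x ≢ y → 2 ≤ ∣ S ∣
  two-members⇒2≤∣∣ {S} {x} {y} x∈S y∈S x≢y =
    subst (_< ∣ S ∣) (Subset.∣⁅x⁆∣≡1 x) (Subset.p⊂q⇒∣p∣<∣q∣ (single⊆S , y , y∈S , y∉single))
    where
    single⊆S : ⁅ x ⁆ Subset.⊆ S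
    single⊆S z∈ = subst (_∈ₛ S) (≡.sym (Subset.x∈⁅y⁆⇒x≡y x z∈)) x∈S
    y∉single : ¬ y ∈ₛ ⁅ x ⁆
    y∉single y∈ = x≢y (≡.sym (Subset.x∈⁅y⁆⇒x≡y x y∈))

  triple : Fin n → Fin n → Fin n → Subset n
  triple x y z = tabulate (λ j → ⌊ j ≟ x ⌋ ∨ ⌊ j ≟ y ⌋ ∨ ⌊ j ≟ z ⌋)

  triple⇒member : ∀ x y z {j} → T (lookup (triple x y z) j) → j ≡ x ⊎ j ≡ y ⊎ j ≡ z
  triple⇒member x y z {j} t with j ≟ x | j ≟ y | j ≟ z | subst T (Vec.lookup∘tabulate _ j) t
  ... | yes j≡x | _       | _       | _ = inj₁ j≡x
  ... | no _    | yes j≡y | _       | _ = inj₂ (inj₁ j≡y)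
  ... | no _    | no _    | yes j≡z | _ = inj₂ (inj₂ j≡z)

  member⇒triple : ∀ x y z {j} → j ≡ x ⊎ j ≡ y ⊎ j ≡ z → T (lookup (triple x y z) j)
  member⇒triple x y z {j} member = subst T (≡.sym (Vec.lookup∘tabulate _ j)) (inTriple member)
    where
    inTriple : j ≡ x ⊎ j ≡ y ⊎ j ≡ z → T (⌊ j ≟ x ⌋ ∨ ⌊ j ≟ y ⌋ ∨ ⌊ j ≟ z ⌋)
    inTriple member with j ≟ x | j ≟ y | j ≟ z
    ... | yes _   | _       | _       = _
    ... | no _    | yes _   | _       = _
    ... | no _    | no _    | yes _   = _
    ... | no j≢x  | no j≢y  | no j≢z  = ⊥-elim ([ j≢x , [ j≢y , j≢z ] ] member)

  triple-∋ : ∀ (x y z : Fin n) {j} → j ≡ x ⊎ j ≡ y ⊎ j ≡ z → j ∈ₛ triple x y z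
  triple-∋ x y z {j} member =
    Vec.lookup⇒[]= j (triple x y z) (Equivalence.to Bool.T-≡ (member⇒triple x y z member))

  2≤∣triple∣ : ∀ {x y z} → x ≢ y → 2 ≤ ∣ triple x y z ∣
  2≤∣triple∣ {x} {y} {z} x≢y =
    two-members⇒2≤∣∣ (triple-∋ x y z (inj₁ refl)) (triple-∋ x y z (inj₂ (inj₁ refl))) x≢y

module _ {n : ℕ} (G : Graph n) where

  collider-imset : ∀ {D x y z} → HasSkeleton D G → Adj G x y → Adj G y z → x ≢ z → ¬ Adj G z x →
                   imsetBool D (triple x y z) ≡ (arrow D x y ∧ arrow D z y)
  collider-imset {D} {x} {y} {z} sk xy yz x≢z z≁x = T-ext sound complete
    where
    S = triple x y z
    x∈S = member⇒triple x y z (inj₁ refl)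
    y∈S = member⇒triple x y z (inj₂ (inj₁ refl))
    z∈S = member⇒triple x y z (inj₂ (inj₂ refl))
    x≢y : x ≢ y
    x≢y refl = adj-irrefl G xy
    z≢y : z ≢ y
    z≢y refl = adj-irrefl G yz
    sound : T (imsetBool D S) → T (arrow D x y ∧ arrow D z y)
    sound t with i , sink ← satisfied (Any.any⁻ _ (allFin n) t) with isSinkOf-sound {D = D} {S = S} sink
    ... | i∈S , parents with triple⇒member x y z i∈S
    ... | inj₁ refl        = ⊥-elim (z≁x (arrow⇒adj G sk (parents z z∈S (x≢z ∘′ ≡.sym))))
    ... | inj₂ (inj₁ refl) = Equivalence.from Bool.T-∧ (parents x x∈S x≢y , parents z z∈S z≢y)
    ... | inj₂ (inj₂ refl) = ⊥-elim (z≁x (adj-sym G (arrow⇒adj G sk (parents x x∈S x≢z))))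
    complete : T (arrow D x y ∧ arrow D z y) → T (imsetBool D S)
    complete t = Any.any⁺ _ (lose (∈-allFin y) (isSinkOf-complete {D = D} {S = S} (y∈S , parents)))
      where
      parents : ∀ j → T (lookup S j) → j ≢ y → Arr D j y
      parents j j∈S j≢y with triple⇒member x y z j∈S
      ... | inj₁ refl        = proj₁ (Equivalence.to Bool.T-∧ t)
      ... | inj₂ (inj₁ refl) = ⊥-elim (j≢y refl)
      ... | inj₂ (inj₂ refl) = proj₂ (Equivalence.to (Bool.T-∧ {arrow D x y}) t)

-- Forests and the cut at an edge

module Forest {n : ℕ} (G : Graph n) (acyclic : Acyclic G) where

  no-triangle : ∀ {x y z} → Adj G x y → Adj G y z → x ≢ z → ¬ Adj G z x
  no-triangle {x} {y} {z} xy yz x≢z zx = acyclic (x ∷ y ∷ z ∷ [])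
    (s≤s (s≤s (s≤s z≤n)) , (distinct , xy ∷ yz ∷ [-]) , z , refl , zx)
    where
    distinct : Unique (x ∷ y ∷ z ∷ [])
    distinct = ((λ { refl → adj-irrefl G xy }) ∷ x≢z ∷ []) ∷
               ((λ { refl → adj-irrefl G yz }) ∷ []) ∷ [] ∷ []

  nonBacktracking-no-return : ∀ x pre post → Linked (Adj G) (x ∷ pre ++ x ∷ post) →
                              Unique (pre ++ x ∷ post) → NonBacktracking (x ∷ pre ++ x ∷ post) → ⊥
  nonBacktracking-no-return x []            post (xx ∷ _) _ _        = adj-irrefl G xx
  nonBacktracking-no-return x (p ∷ [])      post _        _ (x≢x , _) = x≢x refl
  nonBacktracking-no-return x pre@(_ ∷ _ ∷ _) post walk unique _ =
    acyclic (x ∷ pre)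
      (s≤s (s≤s (s≤s z≤n)) , (cycleUnique , Linked-++⁻ˡ (x ∷ pre) walk) , Linked-last x pre walk)
    where
    cycleUnique : Unique (x ∷ pre)
    cycleUnique = All.map (_∘′ ≡.sym) (Unique-++-∉ pre unique) ∷ Unique-++⁻ˡ pre unique

  nonBacktracking⇒unique : ∀ xs → Linked (Adj G) xs → NonBacktracking xs → Unique xs
  nonBacktracking⇒unique []           _         _  = []
  nonBacktracking⇒unique (x ∷ [])     _         _  = [] ∷ []
  nonBacktracking⇒unique (x ∷ y ∷ ys) walk nb
    with uniqueTail ← nonBacktracking⇒unique (y ∷ ys) (Lk.tail walk) (Linked₃-tail (y ∷ ys) nb) =
    ¬Any⇒All¬ (y ∷ ys) (no-return ∘′ ∈-∃++) ∷ uniqueTail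
    where
    no-return : ∃[ pre ] ∃[ post ] (y ∷ ys ≡ pre ++ x ∷ post) → ⊥
    no-return (pre , post , eq) = nonBacktracking-no-return x pre post
      (subst (λ l → Linked (Adj G) (x ∷ l)) eq walk) (subst Unique eq uniqueTail)
      (subst (λ l → NonBacktracking (x ∷ l)) eq nb)

  module Cut (a b : Fin n) (ab : Adj G a b) where

    IsAB : Fin n → Fin n → Set
    IsAB j l = (j ≡ a × l ≡ b) ⊎ (j ≡ b × l ≡ a)

    IsAB-swap : ∀ {j l} → IsAB j l → IsAB l j
    IsAB-swap (inj₁ (j≡a , l≡b)) = inj₂ (l≡b , j≡a)
    IsAB-swap (inj₂ (j≡b , l≡a)) = inj₁ (l≡a , j≡b)

    isAB? : ∀ j l → Dec (IsAB j l)
    isAB? j l = (j ≟ a ×-dec l ≟ b) ⊎-dec (j ≟ b ×-dec l ≟ a)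

    adj∖ab : Fin n → Fin n → Bool
    adj∖ab j l = adj G j l ∧ not ⌊ isAB? j l ⌋

    Adj∖ab : Fin n → Fin n → Set
    Adj∖ab j l = T (adj∖ab j l)

    Adj∖ab-sound : ∀ {j l} → Adj∖ab j l → Adj G j l × ¬ IsAB j l
    Adj∖ab-sound t = let jl , notAB = Equivalence.to Bool.T-∧ t in jl , toWitnessFalse notAB

    Adj∖ab-complete : ∀ {j l} → Adj G j l → ¬ IsAB j l → Adj∖ab j l
    Adj∖ab-complete jl ¬ab = Equivalence.from Bool.T-∧ (jl , fromWitnessFalse ¬ab)

    reach : ℕ → Fin n → Bool
    reach zero    j = ⌊ j ≟ a ⌋
    reach (suc t) j = reach t j ∨ any (λ l → adj∖ab j l ∧ reach t l) (allFin n)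

    WalkToA : ℕ → Fin n → Set
    WalkToA t j = ∃[ ws ] (Linked Adj∖ab (j ∷ ws) × last (j ∷ ws) ≡ just a × length ws ≤ t)

    reach-sound : ∀ t {j} → T (reach t j) → WalkToA t j
    reach-sound zero {j} r with j ≟ a
    ... | yes refl = [] , [-] , refl , z≤n
    reach-sound (suc t) {j} r with Equivalence.to Bool.T-∨ r
    ... | inj₁ r′ =
      let ws , walk , ends , len = reach-sound t r′ in ws , walk , ends , m≤n⇒m≤1+n len
    ... | inj₂ r′ with l , hop ← satisfied (Any.any⁻ _ (allFin n) r′) =
      let jl , rl = Equivalence.to Bool.T-∧ hop
          ws , walk , ends , len = reach-sound t rl
      in l ∷ ws , jl ∷ walk , ends , s≤s len

    reach-a : ∀ t → T (reach t a)
    reach-a zero    = fromWitness refl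
    reach-a (suc t) = Equivalence.from Bool.T-∨ (inj₁ (reach-a t))

    reach-complete : ∀ t {j} ws → Linked Adj∖ab (j ∷ ws) → last (j ∷ ws) ≡ just a → length ws ≤ t →
                     T (reach t j)
    reach-complete t       []       _           refl _         = reach-a t
    reach-complete (suc t) (l ∷ ws) (jl ∷ walk) ends (s≤s len) =
      Equivalence.from Bool.T-∨ (inj₂ (Any.any⁺ _ (lose (∈-allFin l)
        (Equivalence.from Bool.T-∧ (jl , reach-complete t ws walk ends len)))))

    -- side j holds iff j is joined to a in G without the edge ab: a walk reduces to a non-backtracking one,
    -- which in a forest is a path and so has fewer than n steps.
    side : Fin n → Bool
    side = reach n

    side-a : side a ≡ true
    side-a = Equivalence.to Bool.T-≡ (reach-a n)

    side-closed : ∀ {j l} → T (side j) → Adj∖ab l j → T (side l)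
    side-closed {j} {l} sj lj =
      let ws , walk , ends , _       = reach-sound n sj
          rs , walk′ , nb , ends′    = nonBacktracking-reduce _≟_ j ws walk
          path = nonBacktracking⇒unique (j ∷ rs) (Lk.map (proj₁ ∘′ Adj∖ab-sound) walk′) nb
      in reach-complete n (j ∷ rs) (lj ∷ walk′) (trans ends′ ends) (Unique⇒length≤ path)

    -- a walk from b to a avoiding the edge ab would close a cycle through ab
    b-unreachable : ¬ T (side b)
    b-unreachable sb =
      let ws , walk , ends , _       = reach-sound n sb
          rs , walk′ , nb , ends′    = nonBacktracking-reduce _≟_ b ws walk
      in no-cycle rs walk′ nb (trans ends′ ends)
      where
      no-cycle : ∀ rs → Linked Adj∖ab (b ∷ rs) → NonBacktracking (b ∷ rs) → last (b ∷ rs) ≡ just a →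
                 ⊥
      no-cycle []                _        _  ends = adj-irrefl G (subst (Adj G a) (just-injective ends) ab)
      no-cycle (y ∷ [])          (by ∷ _) _  ends =
        proj₂ (Adj∖ab-sound by) (inj₂ (refl , just-injective ends))
      no-cycle rs@(_ ∷ _ ∷ _)    walk     nb ends =
        acyclic (b ∷ rs)
          (s≤s (s≤s (s≤s z≤n)) , (nonBacktracking⇒unique (b ∷ rs) walkG nb , walkG) , a , ends , ab)
        where
        walkG = Lk.map (proj₁ ∘′ Adj∖ab-sound) walk

    side-b : side b ≡ false
    side-b = Bool.¬-not (b-unreachable ∘′ Equivalence.from Bool.T-≡)

    side-constant : ∀ {j l} → Adj G j l → ¬ IsAB j l → side j ≡ side l
    side-constant {j} {l} jl ¬ab with side j in sj | side l in sl
    ... | true  | true  = refl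
    ... | false | false = refl
    ... | true  | false = ⊥-elim (subst T sl (side-closed (Equivalence.from Bool.T-≡ sj)
                                               (Adj∖ab-complete (adj-sym G jl) (¬ab ∘′ IsAB-swap))))
    ... | false | true  = ⊥-elim (subst T sj (side-closed (Equivalence.from Bool.T-≡ sl)
                                               (Adj∖ab-complete jl ¬ab)))

    cut-edge : ∀ {j l} → Adj G j l → side j ≢ side l → IsAB j l
    cut-edge {j} {l} jl differ with isAB? j l
    ... | yes isAB = isAB
    ... | no  ¬ab  = ⊥-elim (differ (side-constant jl ¬ab))

    IsAB-∋a : ∀ {j l} → IsAB j l → j ≡ a ⊎ l ≡ a
    IsAB-∋a (inj₁ (j≡a , _)) = inj₁ j≡a
    IsAB-∋a (inj₂ (_ , l≡a)) = inj₂ l≡a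

    IsAB-∋b : ∀ {j l} → IsAB j l → j ≡ b ⊎ l ≡ b
    IsAB-∋b (inj₁ (_ , l≡b)) = inj₂ l≡b
    IsAB-∋b (inj₂ (j≡b , _)) = inj₁ j≡b

    side-constant-avoiding : ∀ {c L x} → (∀ {j l} → IsAB j l → j ≡ c ⊎ l ≡ c) → All (_≢ c) L →
                             Linked (Adj G) L → x ∈ L → All (λ y → side y ≡ side x) L
    side-constant-avoiding {c} endpoint avoids walk = constant-along side (Linked-map-All same avoids walk)
      where
      same : ∀ {j l} → j ≢ c → l ≢ c → Adj G j l → side j ≡ side l
      same j≢c l≢c jl = side-constant jl ([ j≢c , l≢c ] ∘′ endpoint)

  -- pq is the only edge between the two sides and is oriented p → q in both P and Q, so the mixture
  -- never returns to the side of p once it has left it.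
  cut-mix : ∀ {p q P Q} (pq : Adj G p q) → DAGWithSkeleton G P → DAGWithSkeleton G Q →
            Arr P p q → Arr Q p q → DAGWithSkeleton G (mix (Cut.side p q pq) P Q)
  cut-mix {p} {q} {P} {Q} pq (dagP , skP) (dagQ , skQ) p→q p→q′ =
    mix-dag dagP dagQ noEntry , mix-skeleton G skP skQ crossAgree
    where
    open Cut p q pq
    open Mixing side P Q
    noEntry : ∀ {j l} → side j ≡ false → side l ≡ true → ¬ Arr P j l
    noEntry {j} {l} σj σl j→l
      with cut-edge (arrow⇒adj G skP j→l) (λ σj≡σl → Bool.not-¬ σj (trans σj≡σl σl))
    ... | inj₁ (refl , refl) = Bool.not-¬ σj side-a
    ... | inj₂ (refl , refl) = dag⇒noDigon dagP j→l p→q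
    crossAgree : ∀ {j l} → side j ≢ side l → arrow P j l ≡ arrow Q j l
    crossAgree {j} {l} differ with T? (adj G j l)
    ... | no  j≁l = trans (¬adj⇒arrow≡false G skP j≁l) (≡.sym (¬adj⇒arrow≡false G skQ j≁l))
    ... | yes jl with cut-edge jl differ
    ...   | inj₁ (refl , refl) = trans (Equivalence.to Bool.T-≡ p→q) (≡.sym (Equivalence.to Bool.T-≡ p→q′))
    ...   | inj₂ (refl , refl) = trans (reverse-false {D = P} (dag⇒noDigon dagP) p→q)
                                       (≡.sym (reverse-false {D = Q} (dag⇒noDigon dagQ) p→q′))

-- The collider count along a path moves by at most one along an edge of CIM_G

exchange-counts : ∀ {p q s s′} → q ≡ suc p → 2 + (p + s) ≤ q + s′ →
  (p + s′ ≢ p + s) × (p + s′ ≢ q + s′) × (q + s ≢ p + s) × (q + s ≢ q + s′)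
exchange-counts {p} {_} {s} {s′} refl far =
  (λ e → <⇒≢ s<s′ (≡.sym (+-cancelˡ-≡ p s′ s e))) ,
  (λ e → 1+n≢n (≡.sym e)) ,
  1+n≢n ,
  (λ e → <⇒≢ s<s′ (+-cancelˡ-≡ (suc p) s s′ e))
  where
  s<s′ : s < s′
  s<s′ = +-cancelˡ-≤ p (suc s) s′ (subst (_≤ p + s′) (≡.sym (+-suc p s)) (≤-pred far))

module PathColliders {n : ℕ} (G : Graph n) (acyclic : Acyclic G) (ws : List (Fin n)) (ws-path : IsPath G ws)
  where
  open Forest G acyclic

  Φ : Digraph n → ℕ
  Φ D = colliders (arrow D) ws

  -- In a forest the ends of a path triple x y z are not adjacent, so its collider is c_D({x, y, z}).
  Φ-imset : ∀ {D D′} → HasSkeleton D G → HasSkeleton D′ G → charImset D ≈P charImset D′ → Φ D ≡ Φ D′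
  Φ-imset {D} {D′} sk sk′ same = colliders-cong ws (Linked₃-map ws collider-same (path-triples G ws-path))
    where
    collider-same : ∀ {x y z} → PathTriple G x y z →
                    (arrow D x y ∧ arrow D z y) ≡ (arrow D′ x y ∧ arrow D′ z y)
    collider-same {x} {y} {z} (xy , yz , x≢z) = begin
      arrow D x y ∧ arrow D z y     ≡⟨ collider-imset G sk xy yz x≢z z≁x ⟨
      imsetBool D (triple x y z)    ≡⟨ indicatorℚ-injective (same (triple x y z) (2≤∣triple∣ x≢y)) ⟩
      imsetBool D′ (triple x y z)   ≡⟨ collider-imset G sk′ xy yz x≢z z≁x ⟩
      arrow D′ x y ∧ arrow D′ z y   ∎
      where
      open ≡-Reasoning
      z≁x = no-triangle xy yz x≢z
      x≢y : x ≢ y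
      x≢y refl = adj-irrefl G xy

  path-orientation : ∀ {D} → DAGWithSkeleton G D → Linked (Orientation (arrow D)) ws
  path-orientation (dag , sk) = Lk.map (skeleton-orientation G sk (dag⇒noDigon dag)) (proj₂ ws-path)

  module Split {pre a b post} (splits : ws ≡ pre ++ a ∷ b ∷ post) where

    unique : Unique (pre ++ a ∷ b ∷ post)
    unique = subst Unique splits (proj₁ ws-path)

    walk : Linked (Adj G) (pre ++ a ∷ b ∷ post)
    walk = subst (Linked (Adj G)) splits (proj₂ ws-path)

    ab : Adj G a b
    ab = Lk.head (Linked-++⁻ʳ pre walk)

    regroup : pre ++ a ∷ b ∷ post ≡ (pre ++ a ∷ []) ++ b ∷ post
    regroup = ≡.sym (List.++-assoc pre (a ∷ []) (b ∷ post))

    prefix-walk : Linked (Adj G) (pre ++ a ∷ [])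
    prefix-walk = Linked-++⁻ˡ (pre ++ a ∷ []) (subst (Linked (Adj G)) regroup walk)

    suffix-walk : Linked (Adj G) (b ∷ post)
    suffix-walk = Lk.tail (Linked-++⁻ʳ pre walk)

    b∉prefix : All (_≢ b) (pre ++ a ∷ [])
    b∉prefix = Unique-++-∉ (pre ++ a ∷ []) (subst Unique regroup unique)

    a∉suffix : All (_≢ a) (b ∷ post)
    a∉suffix with Unique-++⁻ʳ pre unique
    ... | a∉ ∷ _ = All.map (_∘′ ≡.sym) a∉

    PRE SUF : List (Fin n)
    PRE = pre ++ a ∷ b ∷ []
    SUF = a ∷ b ∷ post

    Φ-split : ∀ D → Φ D ≡ colliders (arrow D) PRE + colliders (arrow D) SUF
    Φ-split D = trans (cong (colliders (arrow D)) splits) (colliders-split (arrow D) pre a b post)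

    Φ-mix : ∀ σ P Q {s t} → All (λ y → σ y ≡ s) (pre ++ a ∷ []) → All (λ y → σ y ≡ t) (b ∷ post) →
            Φ (mix σ P Q) ≡
            colliders (arrow (if s then P else Q)) PRE + colliders (arrow (if t then P else Q)) SUF
    Φ-mix σ P Q prefixSide suffixSide = trans (Φ-split (mix σ P Q)) (cong₂ _+_
      (subst (λ L → colliders (arrow X) L ≡ colliders (arrow (if _ then P else Q)) L)
             (List.++-assoc pre (a ∷ []) (b ∷ [])) (colliders-mix-∷ʳ (pre ++ a ∷ []) b prefixSide))
      (colliders-mix-∷ a (b ∷ post) suffixSide))
      where open Mixing σ P Q

    record Exchange (A B : Digraph n) : Set where
      field
        X Y       : Digraph n
        X-ok      : DAGWithSkeleton G X
        Y-ok      : DAGWithSkeleton G Y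
        imset-sum : ∀ S → charImset X S ℚ.+ charImset Y S ≡ charImset A S ℚ.+ charImset B S
        Φ-X       : Φ X ≡ colliders (arrow A) PRE + colliders (arrow B) SUF
        Φ-Y       : Φ Y ≡ colliders (arrow B) PRE + colliders (arrow A) SUF

    exchange : ∀ {A B} → DAGWithSkeleton G A → DAGWithSkeleton G B → arrow A a b ≡ arrow B a b →
               Exchange A B
    exchange {A} {B} A-ok@(dagA , skA) B-ok@(dagB , skB) agrees = byOrientation (arrow A a b) refl
      where
      byOrientation : ∀ o → arrow A a b ≡ o → Exchange A B
      byOrientation true a→b = record
        { X = mix side A B ; Y = mix side B A ; X-ok = X-ok ; Y-ok = Y-ok
        ; imset-sum = λ S → charImset-mix side A B S (dag⇒noDigon dagA) (dag⇒noDigon dagB)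
                              (dag⇒noDigon (proj₁ X-ok)) (dag⇒noDigon (proj₁ Y-ok))
        ; Φ-X = Φ-mix side A B prefixSide suffixSide
        ; Φ-Y = Φ-mix side B A prefixSide suffixSide }
        where
        open Cut a b ab
        A-a→b = Equivalence.from Bool.T-≡ a→b
        B-a→b = Equivalence.from Bool.T-≡ (trans (≡.sym agrees) a→b)
        X-ok = cut-mix ab A-ok B-ok A-a→b B-a→b
        Y-ok = cut-mix ab B-ok A-ok B-a→b A-a→b
        prefixSide : All (λ y → side y ≡ true) (pre ++ a ∷ [])
        prefixSide = All.map (λ e → trans e side-a)
          (side-constant-avoiding IsAB-∋b b∉prefix prefix-walk (∈-++⁺ʳ pre (here refl)))
        suffixSide : All (λ y → side y ≡ false) (b ∷ post)
        suffixSide = All.map (λ e → trans e side-b)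
          (side-constant-avoiding IsAB-∋a a∉suffix suffix-walk (here refl))
      byOrientation false a↛b = record
        { X = mix side B A ; Y = mix side A B ; X-ok = X-ok ; Y-ok = Y-ok
        ; imset-sum = λ S → trans (charImset-mix side B A S (dag⇒noDigon dagB) (dag⇒noDigon dagA)
                                     (dag⇒noDigon (proj₁ X-ok)) (dag⇒noDigon (proj₁ Y-ok)))
                                  (ℚ.+-comm (charImset B S) (charImset A S))
        ; Φ-X = Φ-mix side B A prefixSide suffixSide
        ; Φ-Y = Φ-mix side A B prefixSide suffixSide }
        where
        open Cut b a (adj-sym G ab)
        A-b→a = Equivalence.from Bool.T-≡
                  (trans (skeleton-orientation G skA (dag⇒noDigon dagA) ab) (cong not a↛b))
        B-b→a = Equivalence.from Bool.T-≡
                  (trans (skeleton-orientation G skB (dag⇒noDigon dagB) ab)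
                         (cong not (trans (≡.sym agrees) a↛b)))
        X-ok = cut-mix (adj-sym G ab) B-ok A-ok B-b→a A-b→a
        Y-ok = cut-mix (adj-sym G ab) A-ok B-ok A-b→a B-b→a
        prefixSide : All (λ y → side y ≡ false) (pre ++ a ∷ [])
        prefixSide = All.map (λ e → trans e side-b)
          (side-constant-avoiding IsAB-∋a b∉prefix prefix-walk (∈-++⁺ʳ pre (here refl)))
        suffixSide : All (λ y → side y ≡ true) (b ∷ post)
        suffixSide = All.map (λ e → trans e side-a)
          (side-constant-avoiding IsAB-∋b a∉suffix suffix-walk (here refl))

  Φ-separates : ∀ {D D′ w} → HasSkeleton D G → HasSkeleton D′ G → w ≈P charImset D′ → Φ D ≢ Φ D′ →
                ¬ charImset D ≈P w
  Φ-separates sk sk′ w≈D′ Φ≢ D≈w = Φ≢ (Φ-imset sk sk′ (λ S big → trans (D≈w S big) (w≈D′ S big)))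

  edge-step : ∀ {A B u v} → DAGWithSkeleton G A → DAGWithSkeleton G B →
              u ≈P charImset A → v ≈P charImset B → IsEdge G u v → Φ B ≤ 1 + Φ A
  edge-step {A} {B} {u} {v} A-ok B-ok u≈A v≈B edge with Φ B ≤? 1 + Φ A
  ... | yes close = close
  ... | no  far
    with edgeAhead pre a b post splits agrees oneAhead ←
         edge-ahead-of-two (arrow A) (arrow B) ws (path-orientation A-ok) (path-orientation B-ok) (≰⇒> far) =
    ⊥-elim (edge-midpoint {G = G} edge (imset-generator G X-ok) (imset-generator G Y-ok) midpoint
      (Φ-separates skX skA u≈A (subst₂ _≢_ (≡.sym Φ-X) (≡.sym (Φ-split A)) X≢A))
      (Φ-separates skX skB v≈B (subst₂ _≢_ (≡.sym Φ-X) (≡.sym (Φ-split B)) X≢B))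
      (Φ-separates skY skA u≈A (subst₂ _≢_ (≡.sym Φ-Y) (≡.sym (Φ-split A)) Y≢A))
      (Φ-separates skY skB v≈B (subst₂ _≢_ (≡.sym Φ-Y) (≡.sym (Φ-split B)) Y≢B)))
    where
    open Split splits
    open Exchange (exchange A-ok B-ok agrees)
    skA = proj₂ A-ok
    skB = proj₂ B-ok
    skX = proj₂ X-ok
    skY = proj₂ Y-ok
    midpoint : ∀ S → 2 ≤ ∣ S ∣ → charImset X S ℚ.+ charImset Y S ≡ u S ℚ.+ v S
    midpoint S big = trans (imset-sum S) (≡.sym (cong₂ ℚ._+_ (u≈A S big) (v≈B S big)))
    counts = exchange-counts oneAhead
      (subst₂ (λ ΦA ΦB → 2 + ΦA ≤ ΦB) (Φ-split A) (Φ-split B) (≰⇒> far))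
    X≢A = proj₁ counts
    X≢B = proj₁ (proj₂ counts)
    Y≢A = proj₁ (proj₂ (proj₂ counts))
    Y≢B = proj₂ (proj₂ (proj₂ counts))

  walk-bound : ∀ {u z m A Z} → EdgeWalk G u z m → DAGWithSkeleton G A → u ≈P charImset A →
               DAGWithSkeleton G Z → z ≈P charImset Z → Φ Z ≤ m + Φ A
  walk-bound (stay u≈z) (_ , skA) u≈A (_ , skZ) z≈Z =
    ≤-reflexive (Φ-imset skZ skA
      (λ S big → trans (≡.sym (z≈Z S big)) (trans (≡.sym (u≈z S big)) (u≈A S big))))
  walk-bound {m = suc m} {A = A} {Z} (move edge rest) A-ok u≈A Z-ok z≈Z =
    let B , dagB , skB , v≈B = proj₁ (proj₁ (proj₂ edge))
    in begin
      Φ Z             ≤⟨ walk-bound rest (dagB , skB) v≈B Z-ok z≈Z ⟩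
      m + Φ B         ≤⟨ +-monoʳ-≤ m (edge-step A-ok (dagB , skB) u≈A v≈B edge) ⟩
      m + suc (Φ A)   ≡⟨ +-suc m (Φ A) ⟩
      suc m + Φ A     ∎
    where open ≤-Reasoning

-- Increasing and alternating orientations along a path

odd : ℕ → Bool
odd zero    = false
odd (suc k) = not (odd k)

module _ {n : ℕ} where

  position : List (Fin n) → Fin n → ℕ
  position []       j = 0
  position (x ∷ xs) j = if ⌊ j ≟ x ⌋ then 0 else suc (position xs j)

  position-head : ∀ x xs → position (x ∷ xs) x ≡ 0
  position-head x xs with x ≟ x
  ... | yes _   = refl
  ... | no  x≢x = ⊥-elim (x≢x refl)

  position-∷ : ∀ {x j} xs → j ≢ x → position (x ∷ xs) j ≡ suc (position xs j)
  position-∷ {x} {j} xs j≢x with j ≟ x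
  ... | yes j≡x = ⊥-elim (j≢x j≡x)
  ... | no  _   = refl

  Successive : List (Fin n) → Fin n → Fin n → Set
  Successive ws j l = position ws l ≡ suc (position ws j)

  position-successive : ∀ {ws} → Unique ws → Linked (Successive ws) ws
  position-successive {[]}         _                    = []
  position-successive {_ ∷ []}     _                    = [-]
  position-successive {x ∷ y ∷ ws} ((x≢y ∷ x∉) ∷ unique) =
    trans (position-∷ (y ∷ ws) (x≢y ∘′ ≡.sym))
          (cong suc (trans (position-head y ws) (≡.sym (position-head x (y ∷ ws))))) ∷
    Linked-map-All shift (x≢y ∷ x∉) (position-successive unique)
    where
    shift : ∀ {j l} → x ≢ j → x ≢ l → Successive (y ∷ ws) j l → Successive (x ∷ y ∷ ws) j l
    shift x≢j x≢l succ =
      trans (position-∷ (y ∷ ws) (x≢l ∘′ ≡.sym))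
            (trans (cong suc succ) (cong suc (≡.sym (position-∷ (y ∷ ws) (x≢j ∘′ ≡.sym)))))

  -- (k j, j) ordered lexicographically, encoded as a single number
  lexKey : (Fin n → ℕ) → Fin n → ℕ
  lexKey k j = toℕ j + k j * n

  lexKey-injective : ∀ k {i j} → lexKey k i ≡ lexKey k j → i ≡ j
  lexKey-injective k {i} {j} same = Fin.toℕ-injective (begin
    toℕ i                   ≡⟨ m<n⇒m%n≡m (Fin.toℕ<n i) ⟨
    toℕ i % n               ≡⟨ [m+kn]%n≡m%n (toℕ i) (k i) n ⟨
    lexKey k i % n          ≡⟨ cong (_% n) same ⟩
    lexKey k j % n          ≡⟨ [m+kn]%n≡m%n (toℕ j) (k j) n ⟩
    toℕ j % n               ≡⟨ m<n⇒m%n≡m (Fin.toℕ<n j) ⟩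
    toℕ j                   ∎)
    where
    open ≡-Reasoning
    instance
      n≢0 : NonZero n
      n≢0 = Fin.nonZeroIndex i

  lexKey-< : ∀ k {i j} → k j ≡ suc (k i) → lexKey k i < lexKey k j
  lexKey-< k {i} {j} kj≡1+ki = begin-strict
    toℕ i + k i * n         <⟨ +-monoˡ-< (k i * n) (Fin.toℕ<n i) ⟩
    suc (k i) * n           ≤⟨ m≤n+m _ (toℕ j) ⟩
    toℕ j + suc (k i) * n   ≡⟨ cong (λ m → toℕ j + m * n) kj≡1+ki ⟨
    lexKey k j              ∎
    where open ≤-Reasoning

module _ {n : ℕ} (G : Graph n) where

  rankDAG : (Fin n → ℕ) → Digraph n
  arrow (rankDAG k) i j = adj G i j ∧ ⌊ lexKey k i <? lexKey k j ⌋

  rankDAG-arrow⁻ : ∀ k {i j} → Arr (rankDAG k) i j → Adj G i j × lexKey k i < lexKey k j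
  rankDAG-arrow⁻ k i→j = let ij , lt = Equivalence.to Bool.T-∧ i→j in ij , toWitness lt

  rankDAG-arrow⁺ : ∀ k {i j} → Adj G i j → lexKey k i < lexKey k j → Arr (rankDAG k) i j
  rankDAG-arrow⁺ k ij lt = Equivalence.from Bool.T-∧ (ij , fromWitness lt)

  rankDAG-ok : ∀ k → DAGWithSkeleton G (rankDAG k)
  rankDAG-ok k = acyclic , skeleton
    where
    key = lexKey k
    acyclic : IsDAG (rankDAG k)
    acyclic (x ∷ xs) (chain , y , ends , y→x) =
      <⇒≱ (proj₂ (rankDAG-arrow⁻ k y→x)) (All.head upTo-y)
      where
      upTo-y : All (λ v → key v ≤ key y) (x ∷ xs)
      upTo-y = Linked-propagate-back
        (λ j→l l≤y → ≤-trans (<⇒≤ (proj₂ (rankDAG-arrow⁻ k j→l))) l≤y) chain ends ≤-refl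
    skeleton : HasSkeleton (rankDAG k) G
    skeleton i j = mk⇔ orient unorient
      where
      orient : Adj G i j → Arr (rankDAG k) i j ⊎ Arr (rankDAG k) j i
      orient ij with <-cmp (key i) (key j)
      ... | tri< lt _ _ = inj₁ (rankDAG-arrow⁺ k ij lt)
      ... | tri≈ _ eq _ = ⊥-elim (adj-irrefl G (subst (Adj G i) (≡.sym (lexKey-injective k eq)) ij))
      ... | tri> _ _ gt = inj₂ (rankDAG-arrow⁺ k (adj-sym G ij) gt)
      unorient : Arr (rankDAG k) i j ⊎ Arr (rankDAG k) j i → Adj G i j
      unorient (inj₁ i→j) = proj₁ (rankDAG-arrow⁻ k i→j)
      unorient (inj₂ j→i) = adj-sym G (proj₁ (rankDAG-arrow⁻ k j→i))

  module PathOrientations (x : Fin n) (xs : List (Fin n)) (path : IsPath G (x ∷ xs)) where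

    ws = x ∷ xs

    increasing : Digraph n
    increasing = rankDAG (position ws)

    increasing-ok : DAGWithSkeleton G increasing
    increasing-ok = rankDAG-ok (position ws)

    increasing-colliders : colliders (arrow increasing) ws ≡ 0
    increasing-colliders =
      colliders-none ws (Linked₃-map ws noCollider (Linked₃-pairs (position-successive (proj₁ path))))
      where
      noCollider : ∀ {a b c} → Successive ws a b × Successive ws b c →
                   ¬ T (arrow increasing a b ∧ arrow increasing c b)
      noCollider {a} {b} {c} (_ , bc) collider =
        <-asym (lexKey-< (position ws) {b} {c} bc) (proj₂ (rankDAG-arrow⁻ (position ws) c→b))
        where
        c→b = proj₂ (Equivalence.to (Bool.T-∧ {arrow increasing a b}) collider)

    parityKey : Fin n → ℕ
    parityKey j = 𝟙 (odd (position ws j))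

    alternating : Digraph n
    alternating = rankDAG parityKey

    alternating-ok : DAGWithSkeleton G alternating
    alternating-ok = rankDAG-ok parityKey

    alternating-everyOther : ∀ y L → Linked (Successive ws) (y ∷ L) → Linked₃ (PathTriple G) (y ∷ L) →
                             odd (position ws y) ≡ false → EveryOtherCollider (arrow alternating) (y ∷ L)
    alternating-everyOther y []          _               _                          _      = tt
    alternating-everyOther y (z ∷ [])    _               _                          _      = tt
    alternating-everyOther y (z ∷ w ∷ L) (yz ∷ zw ∷ succ) ((y~z , z~w , _) , triples) even-y =
      Equivalence.from Bool.T-∧
        (rankDAG-arrow⁺ parityKey y~z (lexKey-< parityKey {y} {z} up) ,
         rankDAG-arrow⁺ parityKey (adj-sym G z~w) (lexKey-< parityKey {w} {z} down)) ,
      alternating-everyOther w L succ (Linked₃-tail (w ∷ L) triples) even-w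
      where
      up : parityKey z ≡ suc (parityKey y)
      up rewrite yz | even-y = refl
      down : parityKey z ≡ suc (parityKey w)
      down rewrite zw | yz | even-y = refl
      even-w : odd (position ws w) ≡ false
      even-w rewrite zw | yz | even-y = refl

    alternating-colliders : length xs / 2 ≤ colliders (arrow alternating) ws
    alternating-colliders = everyOther⇒colliders x xs (alternating-everyOther x xs
      (position-successive (proj₁ path)) (path-triples G path) (cong odd (position-head x xs)))

mainTheorem3 : ∀ (n : ℕ) (G : Graph n) (p : ℕ) →
    IsTree G → IsMaxPathLength G p → DiamAtLeast G (p / 2)
mainTheorem3 n G p (_ , acyclic) ((x ∷ xs , path , length≡1+p) , _) =
  charImset increasing , charImset alternating ,
  imset-vertex G increasing increasing-ok , imset-vertex G alternating alternating-ok ,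
  λ m walk → begin
    p / 2              ≡⟨ cong (_/ 2) (suc-injective length≡1+p) ⟨
    length xs / 2      ≤⟨ alternating-colliders ⟩
    Φ alternating      ≤⟨ walk-bound walk increasing-ok (λ _ _ → refl) alternating-ok (λ _ _ → refl) ⟩
    m + Φ increasing   ≡⟨ cong (m +_) increasing-colliders ⟩
    m + 0              ≡⟨ +-identityʳ m ⟩
    m                  ∎
  where
  open ≤-Reasoning
  open PathColliders G acyclic (x ∷ xs) path
  open PathOrientations G x xs path
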